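{- Let $j\in\mathbb{N}$ and $r\in\mathbb{N}_0$, and suppose $n\in\mathbb{N}$ has prime factorisation $n=p_1^{a_1}\cdots p_t^{a_t}$. Then \[\frac{c_j^{(r)}(n)}{d_{j+r}(n)}=\sum_{i=0}^j(-1)^i\binom{j}{i}\frac{\binom{j+r-1}{i}^t}{\prod_{k=1}^t\binom{a_k+j+r-1}{i}}={}_{t+1}F_t\big(\{1-j-r\}_{i=1}^t,-j;\{1-a_i-j-r\}_{i=1}^t;1\big).\] Also, for $r\ge 1$, \[\frac{c_j^{(r)}(n)}{d_r(n)}=\sum_{i=0}^j(-1)^{j-i}\binom{j}{i}\frac{\prod_{k=1}^t\binom{a_k+i+r-1}{i}}{\binom{i+r-1}{i}^t}=(-1)^j\,{}_{t+1}F_t\big(\{a_k+r\}_{k=1}^t,-j;\{r\}_{k=1}^t;1\big).\]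
   Context: $\mathbb{N}=\{1,2,\dots\}$, $\mathbb{N}_0=\mathbb{N}\cup\{0\}$. For $j\in\mathbb{N}$, $d_j(n)$ is the number of ordered tuples $(m_1,\dots,m_j)\in\mathbb{N}^j$ with $m_1\cdots m_j=n$, and $c_j(n)$ is the number of such tuples with all $m_i\ge2$. The associated divisor functions are $c_j^{(0)}=c_j$, $c_j^{(r)}(n)=\sum_{m\mid n}c_j^{(r-1)}(m)$ $(r,n\in\mathbb{N})$. The generalised hypergeometric series is ${}_kF_n(a_1,\dots,a_k;b_1,\dots,b_n;z)=\sum_{m=0}^\infty\frac{a_1^{\overline m}\cdots a_k^{\overline m}z^m}{b_1^{\overline m}\cdots b_n^{\overline m}m!}$, where $a^{\overline m}=\prod_{i=0}^{m-1}(a+i)$ is the rising factorial ($a^{\overline 0}=1$); the notation $\{x_i\}_{i=1}^t$ denotes the list of parameters $x_1,\dots,x_t$. -}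

module Defs where

open import Data.Nat as ℕ using (ℕ; zero; suc; _+_; _*_; _∸_; _^_; _≤_)
open import Data.Nat.ListAction using (sum; product)
open import Data.Nat.Combinatorics using (_C_)
open import Data.Nat.Divisibility using (_∣?_)
open import Data.Nat.Primality using (Prime)
open import Data.Integer as ℤ using (ℤ; +_; -_)
open import Data.Rational as ℚ using (ℚ; 0ℚ; 1ℚ)
open import Data.Rational.Properties using (_≟_)
open import Data.List as List using (List; []; _∷_; map; filter; length; upTo; concatMap)
open import Data.List.Relation.Unary.All using (All)
open import Data.List.Relation.Unary.Unique.Propositional using (Unique)
open import Data.Vec as Vec using (Vec)
open import Data.Product using (_×_; proj₁; proj₂)
open import Relation.Binary.PropositionalEquality using (_≡_)
open import Relation.Nullary using (yes; no)

tuples : (j : ℕ) → List ℕ → List (Vec ℕ j)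
tuples zero    xs = Vec.[] ∷ []
tuples (suc j) xs = concatMap (λ x → map (x Vec.∷_) (tuples j xs)) xs

vprod : ∀ {j} → Vec ℕ j → ℕ
vprod v = product (Vec.toList v)

range : ℕ → ℕ → List ℕ
range a b = map (λ k → a + k) (upTo (suc b ∸ a))

-- d_j(n): number of (m_1,...,m_j) ∈ ℕ^j (m_i ≥ 1) with m_1⋯m_j = n.
-- (Any such tuple, for n ≥ 1, has all entries in [1..n].)
d : ℕ → ℕ → ℕ
d j n = length (filter (λ v → vprod v ℕ.≟ n) (tuples j (range 1 n)))

-- c_j(n): number of such tuples with all m_i ≥ 2 (entries then lie in [2..n]).
c : ℕ → ℕ → ℕ
c j n = length (filter (λ v → vprod v ℕ.≟ n) (tuples j (range 2 n)))

divisors : ℕ → List ℕ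
divisors n = filter (_∣? n) (range 1 n)

cr : ℕ → ℕ → ℕ → ℕ
cr j zero    n = c j n
cr j (suc r) n = sum (map (cr j r) (divisors n))

record Factorisation (n : ℕ) : Set where
  field
    factors  : List (ℕ × ℕ)
    primes   : All (λ pa → Prime (proj₁ pa)) factors
    distinct : Unique (map proj₁ factors)
    exps     : All (λ pa → 1 ≤ proj₂ pa) factors
    prodEq   : product (map (λ pa → proj₁ pa ^ proj₂ pa) factors) ≡ n
open Factorisation public

exponents : ∀ {n} → Factorisation n → List ℕ
exponents F = map proj₂ (factors F)

-- total division on ℚ (only ever applied to nonzero denominators below;
-- returns 0 on a zero denominator)
_÷₀_ : ℚ → ℚ → ℚ
p ÷₀ q with q ≟ 0ℚ
... | yes _  = 0ℚ
... | no q≢0 = ℚ._÷_ p q {{ℚ.≢-nonZero q≢0}}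

infixl 7 _÷₀_

ℕtoℚ : ℕ → ℚ
ℕtoℚ n = (+ n) ℚ./ 1

ℤtoℚ : ℤ → ℚ
ℤtoℚ z = z ℚ./ 1

sumℚ : List ℚ → ℚ
sumℚ = List.foldr ℚ._+_ 0ℚ

prodℚ : List ℚ → ℚ
prodℚ = List.foldr ℚ._*_ 1ℚ

sgn : ℕ → ℚ
sgn zero    = 1ℚ
sgn (suc i) = ℚ.- sgn i

rising : ℤ → ℕ → ℤ
rising a zero    = + 1
rising a (suc m) = rising a m ℤ.* (a ℤ.+ + m)

hypTerm : List ℤ → List ℤ → ℕ → ℚ
hypTerm as bs m =
  prodℚ (map (λ a → ℤtoℚ (rising a m)) as)
    ÷₀ (prodℚ (map (λ b → ℤtoℚ (rising b m)) bs) ℚ.* ℕtoℚ (m ℕ.!))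

-- Used only when -N is one of the upper parameters, so that every term with
-- m > N vanishes and this is exactly the (terminating) series.
hypF : List ℤ → List ℤ → ℕ → ℚ
hypF as bs N = sumℚ (map (hypTerm as bs) (upTo (suc N)))

copies : ∀ {A : Set} → ℕ → A → List A
copies zero    x = []
copies (suc t) x = x ∷ copies t x

ratio₁ : ℕ → ℕ → ℕ → ℚ
ratio₁ j r n = ℕtoℚ (cr j r n) ÷₀ ℕtoℚ (d (j + r) n)

sum₁ : ℕ → ℕ → List ℕ → ℚ
sum₁ j r as = sumℚ (map term (upTo (suc j)))
  where
  t = length as
  term : ℕ → ℚ
  term i = (sgn i ℚ.* ℕtoℚ (j C i) ℚ.* ℕtoℚ (((j + r ∸ 1) C i) ^ t))
           ÷₀ prodℚ (map (λ a → ℕtoℚ ((a + j + r ∸ 1) C i)) as)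

hyp₁ : ℕ → ℕ → List ℕ → ℚ
hyp₁ j r as =
  hypF (copies (length as) (+ 1 ℤ.- + (j + r)) List.++ (- (+ j)) ∷ [])
       (map (λ a → + 1 ℤ.- + (a + j + r)) as)
       j

ratio₂ : ℕ → ℕ → ℕ → ℚ
ratio₂ j r n = ℕtoℚ (cr j r n) ÷₀ ℕtoℚ (d r n)

sum₂ : ℕ → ℕ → List ℕ → ℚ
sum₂ j r as = sumℚ (map term (upTo (suc j)))
  where
  t = length as
  term : ℕ → ℚ
  term i = (sgn (j ∸ i) ℚ.* ℕtoℚ (j C i)
              ℚ.* prodℚ (map (λ a → ℕtoℚ ((a + i + r ∸ 1) C i)) as))
           ÷₀ ℕtoℚ (((i + r ∸ 1) C i) ^ t)

hyp₂ : ℕ → ℕ → List ℕ → ℚ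
hyp₂ j r as =
  sgn j ℚ.* hypF (map (λ a → + (a + r)) as List.++ (- (+ j)) ∷ [])
                 (copies (length as) (+ r))
                 j

-- Prepending the cofactor n/m to a j-tuple of factors ≥ 2 with product m ∣ n gives a (j+1)-tuple with
-- product n whose first entry may be 1; hence c_{j+1}(n) + c_j(n) = Σ_{m∣n} c_j(m), and summing over
-- divisors r times, c_{j+1}^{(r)} = c_j^{(r+1)} − c_j^{(r)}.  Since c_0 = d_0 and d_{k+1}(n) = Σ_{m∣n} d_k(m),
-- induction on (j, r) gives
--   c_j^{(r)}(n) = Σ_{i=0}^{j} (−1)^{j−i} C(j,i) d_{i+r}(n).
-- The divisor function d_k is multiplicative with d_k(p^a) = C(a+k−1, a) (by the hockey-stick identity), so
-- dividing by d_{j+r}(n) or by d_r(n) turns each term into a product over the exponents of ratios of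
-- binomial coefficients, which match termwise by trinomial symmetry C(x+y+z,x)C(y+z,y) = C(x+y+z,y)C(x+z,x).
-- The hypergeometric terms are the same products, by (−x)^{\overline m} = (−1)^m m! C(x,m) and
-- (y+1)^{\overline m} = m! C(y+m,m).
module Submission where

open import Defs
open import Data.Nat using (ℕ; _≤_)
open import Data.Product using (_×_; _,_)
open import Relation.Binary.PropositionalEquality using (_≡_)
open import Algebra.Structures using (IsCommutativeSemiring; IsCommutativeRing)
import Data.Nat.Properties as ℕP
import Data.Rational.Properties as ℚP


module Sums {A : Set} {_+_ _*_ : A → A → A} {0# 1# : A}
  (isCS : IsCommutativeSemiring _≡_ _+_ _*_ 0# 1#) where
  open import Data.Nat.Base using (ℕ; zero; suc; _∸_)
  open import Data.List.Base using (List; []; _∷_; _++_; [_]; _∷ʳ_; map; foldr; concatMap; upTo)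
  open import Data.List.Properties using (map-cong-local; map-++; map-applyUpTo; map-upTo; upTo-∷ʳ)
  import Data.List.Relation.Unary.All as All
  open import Data.List.Membership.Propositional using (_∈_)
  open import Function.Base using (_∘_)
  open import Relation.Binary.PropositionalEquality using (_≡_; refl; sym; trans; cong; module ≡-Reasoning)
  open IsCommutativeSemiring isCS
    using (+-assoc; +-comm; +-identityˡ; +-identityʳ; distribˡ; distribʳ; zeroˡ; zeroʳ)

  private variable B C : Set

  Σ : List A → A
  Σ = foldr _+_ 0#

  Σ-++ : ∀ xs ys → Σ (xs ++ ys) ≡ Σ xs + Σ ys
  Σ-++ []       ys = sym (+-identityˡ _)
  Σ-++ (x ∷ xs) ys = trans (cong (x +_) (Σ-++ xs ys)) (sym (+-assoc x _ _))

  Σ-map-cong-∈ : ∀ {f g : B → A} xs → (∀ {x} → x ∈ xs → f x ≡ g x) →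
                 Σ (map f xs) ≡ Σ (map g xs)
  Σ-map-cong-∈ xs f≡g = cong Σ (map-cong-local (All.tabulate f≡g))

  Σ-map-0 : (xs : List C) → Σ (map (λ _ → 0#) xs) ≡ 0#
  Σ-map-0 []       = refl
  Σ-map-0 (x ∷ xs) = trans (+-identityˡ _) (Σ-map-0 xs)

  Σ-map-+ : ∀ (f g : B → A) xs →
            Σ (map (λ x → f x + g x) xs) ≡ Σ (map f xs) + Σ (map g xs)
  Σ-map-+ f g []       = sym (+-identityˡ 0#)
  Σ-map-+ f g (x ∷ xs) = begin
    (f x + g x) + Σ (map (λ x → f x + g x) xs)   ≡⟨ cong (_ +_) (Σ-map-+ f g xs) ⟩
    (f x + g x) + (F + G)                       ≡⟨ +-assoc (f x) (g x) _ ⟩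
    f x + (g x + (F + G))                       ≡⟨ cong (f x +_) (sym (+-assoc (g x) F G)) ⟩
    f x + ((g x + F) + G)                       ≡⟨ cong (λ y → f x + (y + G)) (+-comm (g x) F) ⟩
    f x + ((F + g x) + G)                       ≡⟨ cong (f x +_) (+-assoc F (g x) G) ⟩
    f x + (F + (g x + G))                       ≡⟨ sym (+-assoc (f x) F _) ⟩
    (f x + F) + (g x + G)                       ∎
    where
    open ≡-Reasoning
    F = Σ (map f xs)
    G = Σ (map g xs)

  Σ-map-*ˡ : ∀ c (f : B → A) xs → Σ (map (λ x → c * f x) xs) ≡ c * Σ (map f xs)
  Σ-map-*ˡ c f []       = sym (zeroʳ c)
  Σ-map-*ˡ c f (x ∷ xs) = trans (cong ((c * f x) +_) (Σ-map-*ˡ c f xs)) (sym (distribˡ c (f x) _))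

  Σ-map-*ʳ : ∀ c (f : B → A) xs → Σ (map (λ x → f x * c) xs) ≡ Σ (map f xs) * c
  Σ-map-*ʳ c f []       = sym (zeroˡ c)
  Σ-map-*ʳ c f (x ∷ xs) = trans (cong ((f x * c) +_) (Σ-map-*ʳ c f xs)) (sym (distribʳ c (f x) _))

  Σ-concatMap : ∀ (f : C → A) (h : B → List C) xs →
                Σ (map f (concatMap h xs)) ≡ Σ (map (λ x → Σ (map f (h x))) xs)
  Σ-concatMap f h []       = refl
  Σ-concatMap f h (x ∷ xs) = begin
    Σ (map f (h x ++ concatMap h xs))             ≡⟨ cong Σ (map-++ f (h x) _) ⟩
    Σ (map f (h x) ++ map f (concatMap h xs))     ≡⟨ Σ-++ (map f (h x)) _ ⟩
    Σ (map f (h x)) + Σ (map f (concatMap h xs))  ≡⟨ cong (_ +_) (Σ-concatMap f h xs) ⟩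
    Σ (map f (h x)) + Σ (map (λ x → Σ (map f (h x))) xs) ∎
    where open ≡-Reasoning

  Σ-swap : ∀ (f : B → C → A) xs ys →
           Σ (map (λ x → Σ (map (f x) ys)) xs) ≡ Σ (map (λ y → Σ (map (λ x → f x y) xs)) ys)
  Σ-swap f []       ys = sym (Σ-map-0 ys)
  Σ-swap f (x ∷ xs) ys = trans (cong (_ +_) (Σ-swap f xs ys))
    (sym (Σ-map-+ (f x) (λ y → Σ (map (λ x → f x y) xs)) ys))

  Σ-upTo-suc : ∀ (f : ℕ → A) n → Σ (map f (upTo (suc n))) ≡ f 0 + Σ (map (f ∘ suc) (upTo n))
  Σ-upTo-suc f n = cong (λ xs → f 0 + Σ xs)
    (trans (map-applyUpTo suc f n) (sym (map-upTo (f ∘ suc) n)))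

  Σ-upTo-∷ʳ : ∀ (f : ℕ → A) n → Σ (map f (upTo (suc n))) ≡ Σ (map f (upTo n)) + f n
  Σ-upTo-∷ʳ f n = begin
    Σ (map f (upTo (suc n)))             ≡⟨ cong (Σ ∘ map f) (sym (upTo-∷ʳ n)) ⟩
    Σ (map f (upTo n ∷ʳ n))              ≡⟨ cong Σ (map-++ f (upTo n) [ n ]) ⟩
    Σ (map f (upTo n) ++ [ f n ])        ≡⟨ Σ-++ (map f (upTo n)) [ f n ] ⟩
    Σ (map f (upTo n)) + (f n + 0#)      ≡⟨ cong (Σ (map f (upTo n)) +_) (+-identityʳ (f n)) ⟩
    Σ (map f (upTo n)) + f n             ∎
    where open ≡-Reasoning

  Σ-upTo-reverse : ∀ (f : ℕ → A) n →
                   Σ (map f (upTo (suc n))) ≡ Σ (map (λ i → f (n ∸ i)) (upTo (suc n)))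
  Σ-upTo-reverse f zero    = refl
  Σ-upTo-reverse f (suc n) = begin
    Σ (map f (upTo (suc (suc n))))
      ≡⟨ Σ-upTo-∷ʳ f (suc n) ⟩
    Σ (map f (upTo (suc n))) + f (suc n)
      ≡⟨ +-comm _ (f (suc n)) ⟩
    f (suc n) + Σ (map f (upTo (suc n)))
      ≡⟨ cong (f (suc n) +_) (Σ-upTo-reverse f n) ⟩
    f (suc n) + Σ (map (λ i → f (n ∸ i)) (upTo (suc n)))
      ≡⟨ sym (Σ-upTo-suc (λ i → f (suc n ∸ i)) (suc n)) ⟩
    Σ (map (λ i → f (suc n ∸ i)) (upTo (suc (suc n))))
      ∎
    where open ≡-Reasoning


module ℕ-Sums = Sums ℕP.+-*-isCommutativeSemiring


module ℚ-Sums = Sums (IsCommutativeRing.isCommutativeSemiring ℚP.+-*-isCommutativeRing)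


module Binomial where
  open import Data.Nat.Base
  open import Data.Nat.Properties
  open import Data.Nat.Combinatorics
    using (_C_; nCk≡n!/k![n-k]!; k![n∸k]!∣n!; k>n⇒nCk≡0; nCk+nC[k+1]≡[n+1]C[k+1])
  open import Data.Nat.DivMod using (m/n*n≡m)
  open import Data.Nat.ListAction using (sum)
  open import Data.List.Base using (map; upTo)
  open import Data.Nat.Tactic.RingSolver using (solve-∀)
  open import Relation.Binary.PropositionalEquality
  open import Relation.Nullary.Decidable using (yes; no)
  open ℕ-Sums using (Σ-upTo-∷ʳ)

  C-factorial′ : ∀ {n k} → k ≤ n → (n C k) * (k ! * (n ∸ k) !) ≡ n !
  C-factorial′ {n} {k} k≤n = begin
    (n C k) * (k ! * (n ∸ k) !)
      ≡⟨ cong (_* (k ! * (n ∸ k) !)) (nCk≡n!/k![n-k]! k≤n) ⟩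
    n ! / (k ! * (n ∸ k) !) * (k ! * (n ∸ k) !)
      ≡⟨ m/n*n≡m (k![n∸k]!∣n! k≤n) ⟩
    n !
      ∎
    where
    open ≡-Reasoning
    instance _ = k !* (n ∸ k) !≢0

  C-factorial : ∀ m n → ((m + n) C m) * (m ! * n !) ≡ (m + n) !
  C-factorial m n = subst (λ k → ((m + n) C m) * (m ! * k !) ≡ (m + n) !)
    (m+n∸m≡n m n) (C-factorial′ (m≤m+n m n))

  C≢0 : ∀ {n k} → k ≤ n → n C k ≢ 0
  C≢0 {n} {k} k≤n C≡0 = ≢-nonZero⁻¹ (n !) {{n !≢0}}
    (trans (sym (C-factorial′ k≤n)) (cong (_* (k ! * (n ∸ k) !)) C≡0))

  C-absorb : ∀ n k → suc k * (suc n C suc k) ≡ suc n * (n C k)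
  C-absorb n k with k ≤? n
  ... | no k≰n = begin
    suc k * (suc n C suc k)  ≡⟨ cong (suc k *_) (k>n⇒nCk≡0 (s≤s (≰⇒> k≰n))) ⟩
    suc k * 0                ≡⟨ *-zeroʳ (suc k) ⟩
    0                        ≡⟨ sym (*-zeroʳ (suc n)) ⟩
    suc n * 0                ≡⟨ cong (suc n *_) (sym (k>n⇒nCk≡0 (≰⇒> k≰n))) ⟩
    suc n * (n C k)          ∎
    where open ≡-Reasoning
  ... | yes k≤n = *-cancelʳ-≡ _ _ (k ! * (n ∸ k) !) {{k !* (n ∸ k) !≢0}} (begin
    suc k * (suc n C suc k) * (k ! * (n ∸ k) !)   ≡⟨ shuffle (suc k) (suc n C suc k) (k !) ((n ∸ k) !) ⟩
    (suc n C suc k) * (suc k ! * (n ∸ k) !)       ≡⟨ C-factorial′ (s≤s k≤n) ⟩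
    suc n !                                       ≡⟨ cong (suc n *_) (sym (C-factorial′ k≤n)) ⟩
    suc n * ((n C k) * (k ! * (n ∸ k) !))         ≡⟨ sym (*-assoc (suc n) (n C k) _) ⟩
    suc n * (n C k) * (k ! * (n ∸ k) !)           ∎)
    where
    open ≡-Reasoning
    shuffle : ∀ a b c d → a * b * (c * d) ≡ b * (a * c * d)
    shuffle = solve-∀

  C-trinomial : ∀ x y z → ((x + y + z) C x) * ((y + z) C y) ≡ ((x + y + z) C y) * ((x + z) C x)
  C-trinomial x y z = *-cancelʳ-≡ _ _ (x ! * (y ! * z !)) {{m*n≢0 (x !) (y ! * z !)}} (trans left (sym right))
    where
    instance
      _ = x !≢0
      _ = y !* z !≢0
    open ≡-Reasoning
    left : ((x + y + z) C x) * ((y + z) C y) * (x ! * (y ! * z !)) ≡ (x + y + z) !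
    left rewrite +-assoc x y z = begin
      ((x + (y + z)) C x) * ((y + z) C y) * (x ! * (y ! * z !))
        ≡⟨ shuffle ((x + (y + z)) C x) ((y + z) C y) (x !) (y !) (z !) ⟩
      ((x + (y + z)) C x) * (x ! * (((y + z) C y) * (y ! * z !)))
        ≡⟨ cong (λ w → ((x + (y + z)) C x) * (x ! * w)) (C-factorial y z) ⟩
      ((x + (y + z)) C x) * (x ! * (y + z) !)
        ≡⟨ C-factorial x (y + z) ⟩
      (x + (y + z)) !
        ∎
      where
      shuffle : ∀ a b p q r → a * b * (p * (q * r)) ≡ a * (p * (b * (q * r)))
      shuffle = solve-∀
    right : ((x + y + z) C y) * ((x + z) C x) * (x ! * (y ! * z !)) ≡ (x + y + z) !
    right rewrite +-comm x y | +-assoc y x z = begin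
      ((y + (x + z)) C y) * ((x + z) C x) * (x ! * (y ! * z !))
        ≡⟨ shuffle ((y + (x + z)) C y) ((x + z) C x) (x !) (y !) (z !) ⟩
      ((y + (x + z)) C y) * (y ! * (((x + z) C x) * (x ! * z !)))
        ≡⟨ cong (λ w → ((y + (x + z)) C y) * (y ! * w)) (C-factorial x z) ⟩
      ((y + (x + z)) C y) * (y ! * (x + z) !)
        ≡⟨ C-factorial y (x + z) ⟩
      (y + (x + z)) !
        ∎
      where
      shuffle : ∀ a b p q r → a * b * (p * (q * r)) ≡ a * (q * (b * (p * r)))
      shuffle = solve-∀

  C-hockey-stick : ∀ k a → sum (map (λ e → (e + k) C e) (upTo (suc a))) ≡ suc (a + k) C a
  C-hockey-stick k zero    = refl
  C-hockey-stick k (suc a) = begin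
    sum (map (λ e → (e + k) C e) (upTo (suc (suc a))))
      ≡⟨ Σ-upTo-∷ʳ (λ e → (e + k) C e) (suc a) ⟩
    sum (map (λ e → (e + k) C e) (upTo (suc a))) + (suc a + k) C suc a
      ≡⟨ cong (_+ (suc a + k) C suc a) (C-hockey-stick k a) ⟩
    suc (a + k) C a + suc (a + k) C suc a
      ≡⟨ nCk+nC[k+1]≡[n+1]C[k+1] (suc (a + k)) a ⟩
    suc (suc a + k) C suc a
      ∎
    where open ≡-Reasoning


module FilterCounting where
  open import Data.Nat.Base using (ℕ; suc; _+_)
  open import Data.Nat.ListAction using (sum)
  open import Data.Nat.ListAction.Properties using (sum-↭)
  open import Data.List.Base using (List; []; _∷_; _++_; map; filter; length; concatMap)
  open import Data.List.Properties using (length-++; filter-++)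
  open import Data.List.Membership.Propositional using (_∈_)
  open import Data.List.Membership.Propositional.Properties.WithK using (unique∧set⇒bag)
  open import Data.List.Relation.Unary.Unique.Propositional using (Unique)
  import Data.List.Relation.Binary.Permutation.Propositional.Properties as ↭
  open import Data.List.Relation.Binary.BagAndSetEquality using (∼bag⇒↭)
  open import Function.Base using (_∘_)
  open import Function.Bundles using (mk⇔)
  open import Relation.Binary.PropositionalEquality using (_≡_; refl; trans; cong; cong₂)
  open import Relation.Nullary using (¬_; yes; no)
  open import Relation.Unary using (Decidable)

  private variable A B : Set

  length-filter-++ : ∀ {P : A → Set} (P? : Decidable P) xs ys →
    length (filter P? (xs ++ ys)) ≡ length (filter P? xs) + length (filter P? ys)
  length-filter-++ P? xs ys = trans (cong length (filter-++ P? xs ys)) (length-++ (filter P? xs))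

  length-filter-map : ∀ {P : A → Set} (P? : Decidable P) (f : B → A) xs →
    length (filter P? (map f xs)) ≡ length (filter (P? ∘ f) xs)
  length-filter-map P? f []       = refl
  length-filter-map P? f (x ∷ xs) with P? (f x)
  ... | yes _ = cong suc (length-filter-map P? f xs)
  ... | no  _ = length-filter-map P? f xs

  length-filter-concatMap : ∀ {P : A → Set} (P? : Decidable P) (f : B → List A) xs →
    length (filter P? (concatMap f xs)) ≡ sum (map (λ x → length (filter P? (f x))) xs)
  length-filter-concatMap P? f []       = refl
  length-filter-concatMap P? f (x ∷ xs) = trans (length-filter-++ P? (f x) (concatMap f xs))
    (cong (length (filter P? (f x)) +_) (length-filter-concatMap P? f xs))

  sum-map-filter : ∀ {P : A → Set} (P? : Decidable P) (f g : A → ℕ) →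
    (∀ x → P x → f x ≡ g x) → (∀ x → ¬ P x → f x ≡ 0) →
    ∀ xs → sum (map f xs) ≡ sum (map g (filter P? xs))
  sum-map-filter P? f g f≡g f≡0 []       = refl
  sum-map-filter P? f g f≡g f≡0 (x ∷ xs) with P? x
  ... | yes px = cong₂ _+_ (f≡g x px) (sum-map-filter P? f g f≡g f≡0 xs)
  ... | no ¬px = trans (cong (_+ sum (map f xs)) (f≡0 x ¬px)) (sum-map-filter P? f g f≡g f≡0 xs)

  sum-map-set-equal : ∀ (g : A → ℕ) {xs ys} → Unique xs → Unique ys →
    (∀ {z} → z ∈ xs → z ∈ ys) → (∀ {z} → z ∈ ys → z ∈ xs) → sum (map g xs) ≡ sum (map g ys)
  sum-map-set-equal g ux uy xs⊆ys ys⊆xs =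
    sum-↭ (↭.map⁺ g (∼bag⇒↭ (unique∧set⇒bag ux uy (mk⇔ xs⊆ys ys⊆xs))))


module Divisors where
  open import Data.Nat.Base
  open import Data.Nat.Properties
  open import Data.Nat.DivMod using (_/_; m*n/n≡m; m*[n/m]≡n; m/n≤m)
  open import Data.Nat.Divisibility using (_∣_; divides; _∣?_; ∣⇒≤; 0∣⇒≡0)
  open import Data.Nat.ListAction using (sum)
  open import Data.List.Base using (List; map; filter)
  open import Data.List.Properties using (map-∘; map-id; map-cong-local)
  open import Data.List.Membership.Propositional using (_∈_)
  open import Data.List.Membership.Propositional.Properties
    using (∈-map⁺; ∈-map⁻; ∈-filter⁺; ∈-filter⁻; ∈-upTo⁺; ∈-upTo⁻)
  import Data.List.Relation.Unary.All as All
  open import Data.List.Relation.Unary.Unique.Propositional using (Unique)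
  import Data.List.Relation.Unary.Unique.Propositional.Properties as Unique
  open import Data.Product.Base using (_×_; _,_; proj₁; proj₂)
  open import Function.Base using (_∘_)
  open import Relation.Binary.PropositionalEquality
  open import Relation.Nullary using (contradiction)
  open import Defs using (range; divisors)
  open FilterCounting using (sum-map-set-equal)

  -- The value at x = 0 is junk: 0 divides no positive number.
  cofactor : ℕ → ℕ → ℕ
  cofactor m zero    = 0
  cofactor m (suc x) = m / suc x

  module _ {m : ℕ} (1≤m : 1 ≤ m) where

    ∣⇒*-cofactor : ∀ {x} → x ∣ m → x * cofactor m x ≡ m
    ∣⇒*-cofactor {zero}  0∣m = contradiction (0∣⇒≡0 0∣m) (≢-nonZero⁻¹ m {{>-nonZero 1≤m}})
    ∣⇒*-cofactor {suc x} x∣m = m*[n/m]≡n x∣m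

    *≡⇒cofactor : ∀ {x p} → x * p ≡ m → p ≡ cofactor m x
    *≡⇒cofactor {zero}  0≡m = contradiction (sym 0≡m) (≢-nonZero⁻¹ m {{>-nonZero 1≤m}})
    *≡⇒cofactor {suc x} {p} x*p≡m = sym (trans (cong (_/ suc x) (trans (sym x*p≡m) (*-comm (suc x) p)))
                                              (m*n/n≡m p (suc x)))

    cofactor-∣ : ∀ {x} → x ∣ m → cofactor m x ∣ m
    cofactor-∣ {x} x∣m = divides x (sym (∣⇒*-cofactor x∣m))

    cofactor-positive : ∀ {x} → x ∣ m → 1 ≤ cofactor m x
    cofactor-positive {x} x∣m with cofactor m x | ∣⇒*-cofactor x∣m
    ... | zero  | x*0≡m = contradiction (trans (sym x*0≡m) (*-zeroʳ x)) (≢-nonZero⁻¹ m {{>-nonZero 1≤m}})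
    ... | suc _ | _     = s≤s z≤n

    cofactor-involutive : ∀ {x} → x ∣ m → cofactor m (cofactor m x) ≡ x
    cofactor-involutive {x} x∣m =
      sym (*≡⇒cofactor {cofactor m x} {x} (trans (*-comm (cofactor m x) x) (∣⇒*-cofactor x∣m)))

  cofactor-≤ : ∀ m x → cofactor m x ≤ m
  cofactor-≤ m zero    = z≤n
  cofactor-≤ m (suc x) = m/n≤m m (suc x)

  ∈-range⁻ : ∀ {a N z} → z ∈ range a N → a ≤ z × z ≤ N
  ∈-range⁻ {a} {N} z∈ with ∈-map⁻ (a +_) z∈
  ... | i , i∈ , refl =
    m≤m+n a i , subst (_≤ N) (+-comm i a) (≤-pred (m≤o∸n⇒m+n≤o (suc i) a≤1+N i<))
    where
    i< : suc i ≤ suc N ∸ a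
    i< = ∈-upTo⁻ i∈
    a≤1+N : a ≤ suc N
    a≤1+N = <⇒≤ (m∸n≢0⇒n<m (λ e → 1+n≢0 (n≤0⇒n≡0 (subst (suc i ≤_) e i<))))

  ∈-range⁺ : ∀ {a N z} → a ≤ z → z ≤ N → z ∈ range a N
  ∈-range⁺ {a} {N} {z} a≤z z≤N = subst (_∈ range a N) (m+[n∸m]≡n a≤z)
    (∈-map⁺ (a +_) (∈-upTo⁺ (∸-monoˡ-< (s≤s z≤N) a≤z)))

  range-unique : ∀ a N → Unique (range a N)
  range-unique a N = Unique.map⁺ (+-cancelˡ-≡ a _ _) (Unique.upTo⁺ _)

  boundedDivisors : ℕ → ℕ → ℕ → List ℕ
  boundedDivisors a N m = filter (_∣? m) (range a N)

  boundedDivisors-unique : ∀ a N m → Unique (boundedDivisors a N m)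
  boundedDivisors-unique a N m = Unique.filter⁺ (_∣? m) (range-unique a N)

  ∈-boundedDivisors⁻ : ∀ {a N m z} → z ∈ boundedDivisors a N m → a ≤ z × z ≤ N × z ∣ m
  ∈-boundedDivisors⁻ {a} {N} {m} z∈ with ∈-filter⁻ (_∣? m) {xs = range a N} z∈
  ... | z∈range , z∣m = proj₁ (∈-range⁻ z∈range) , proj₂ (∈-range⁻ z∈range) , z∣m

  ∈-boundedDivisors⇒∣ : ∀ {a N m z} → z ∈ boundedDivisors a N m → z ∣ m
  ∈-boundedDivisors⇒∣ {a} {N} z∈ = proj₂ (proj₂ (∈-boundedDivisors⁻ {a} {N} z∈))

  ∈-boundedDivisors⁺ : ∀ {a N m z} → a ≤ z → z ≤ N → z ∣ m → z ∈ boundedDivisors a N m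
  ∈-boundedDivisors⁺ {m = m} a≤z z≤N z∣m = ∈-filter⁺ (_∣? m) (∈-range⁺ a≤z z≤N) z∣m

  ∣⇒≤′ : ∀ {z m} → 1 ≤ m → z ∣ m → z ≤ m
  ∣⇒≤′ {m = suc m} _ = ∣⇒≤

  ∣⇒positive : ∀ {z m} → 1 ≤ m → z ∣ m → 1 ≤ z
  ∣⇒positive {zero}  {suc m} _ 0∣m = contradiction (0∣⇒≡0 0∣m) λ ()
  ∣⇒positive {suc z}         _ _   = s≤s z≤n

  sum-boundedDivisors-bound : ∀ a {N m} (g : ℕ → ℕ) → 1 ≤ m → m ≤ N →
    sum (map g (boundedDivisors a N m)) ≡ sum (map g (boundedDivisors a m m))
  sum-boundedDivisors-bound a {N} {m} g 1≤m m≤N =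
    sum-map-set-equal g (boundedDivisors-unique a N m) (boundedDivisors-unique a m m) shrink grow
    where
    shrink : ∀ {z} → z ∈ boundedDivisors a N m → z ∈ boundedDivisors a m m
    shrink z∈ with ∈-boundedDivisors⁻ {a} {N} {m} z∈
    ... | a≤z , _ , z∣m = ∈-boundedDivisors⁺ a≤z (∣⇒≤′ 1≤m z∣m) z∣m
    grow : ∀ {z} → z ∈ boundedDivisors a m m → z ∈ boundedDivisors a N m
    grow z∈ with ∈-boundedDivisors⁻ {a} {m} {m} z∈
    ... | a≤z , z≤m , z∣m = ∈-boundedDivisors⁺ a≤z (≤-trans z≤m m≤N) z∣m

  divisors-unique : ∀ n → Unique (divisors n)
  divisors-unique n = boundedDivisors-unique 1 n n

  ∈-divisors⁻ : ∀ {n z} → z ∈ divisors n → z ∣ n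
  ∈-divisors⁻ {n} = ∈-boundedDivisors⇒∣ {1} {n}

  ∈-divisors⁺ : ∀ {n z} → 1 ≤ n → z ∣ n → z ∈ divisors n
  ∈-divisors⁺ {suc n} {zero} _ 0∣n = contradiction (0∣⇒≡0 0∣n) λ ()
  ∈-divisors⁺ {suc n} {suc z} _ z∣n = ∈-boundedDivisors⁺ (s≤s z≤n) (∣⇒≤ z∣n) z∣n

  sum-divisors-cofactor : ∀ {n} (g : ℕ → ℕ) → 1 ≤ n →
    sum (map (g ∘ cofactor n) (divisors n)) ≡ sum (map g (divisors n))
  sum-divisors-cofactor {n} g 1≤n = trans (cong sum (map-∘ (divisors n)))
    (sum-map-set-equal g cofactors-unique (divisors-unique n) cofactor-∈ ∈-cofactors)
    where
    cofactors = map (cofactor n) (divisors n)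
    cofactor-twice : map (cofactor n) cofactors ≡ divisors n
    cofactor-twice = trans (sym (map-∘ (divisors n)))
      (trans (map-cong-local (All.tabulate (cofactor-involutive 1≤n ∘ ∈-divisors⁻))) (map-id (divisors n)))
    cofactors-unique : Unique cofactors
    cofactors-unique = Unique.map⁻ (subst Unique (sym cofactor-twice) (divisors-unique n))
    cofactor-∈ : ∀ {z} → z ∈ cofactors → z ∈ divisors n
    cofactor-∈ z∈ with ∈-map⁻ (cofactor n) z∈
    ... | x , x∈ , refl = ∈-divisors⁺ 1≤n (cofactor-∣ 1≤n (∈-divisors⁻ x∈))
    ∈-cofactors : ∀ {z} → z ∈ divisors n → z ∈ cofactors
    ∈-cofactors z∈ = subst (_∈ cofactors) (cofactor-involutive 1≤n (∈-divisors⁻ z∈))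
      (∈-map⁺ (cofactor n) (∈-divisors⁺ 1≤n (cofactor-∣ 1≤n (∈-divisors⁻ z∈))))


module TupleCounting where
  open import Data.Nat.Base
  open import Data.Nat.Properties
  open import Data.Nat.DivMod using (n/1≡n)
  open import Data.Nat.Divisibility using (_∣_; divides; _∣?_; 1∣_)
  open import Data.Nat.ListAction using (sum)
  open import Data.List.Base using (List; _∷_; map; filter; length)
  open import Data.List.Properties using (filter-≐; filter-none; filter-accept; map-upTo; map-applyUpTo)
  open import Data.List.Membership.Propositional using (_∈_)
  import Data.List.Relation.Unary.All as All
  import Data.Vec.Base as Vec
  open import Data.Product.Base using (_,_)
  open import Function.Base using (_∘_)
  open import Relation.Binary.PropositionalEquality
  open import Relation.Nullary using (¬_)
  open import Defs using (tuples; vprod; range; d; c; cr; divisors)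
  open ℕ-Sums using (Σ-map-cong-∈)
  open FilterCounting using (length-filter-map; length-filter-concatMap; sum-map-filter)
  open Divisors

  tupleCount : List ℕ → ℕ → ℕ → ℕ
  tupleCount xs k m = length (filter (λ v → vprod v ≟ m) (tuples k xs))

  tupleCount-suc : ∀ xs k {m} → 1 ≤ m →
    tupleCount xs (suc k) m ≡ sum (map (λ x → tupleCount xs k (cofactor m x)) (filter (_∣? m) xs))
  tupleCount-suc xs k {m} 1≤m =
    trans (length-filter-concatMap _ (λ x → map (x Vec.∷_) (tuples k xs)) xs)
          (sum-map-filter (_∣? m) _ _ divisor non-divisor xs)
    where
    count-from : ℕ → ℕ
    count-from x = length (filter (λ v → vprod v ≟ m) (map (x Vec.∷_) (tuples k xs)))
    divisor : ∀ x → x ∣ m → count-from x ≡ tupleCount xs k (cofactor m x)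
    divisor x x∣m = trans (length-filter-map _ (x Vec.∷_) (tuples k xs))
      (cong length (filter-≐ (λ v → x * vprod v ≟ m) (λ v → vprod v ≟ cofactor m x)
                     (*≡⇒cofactor 1≤m {x} , λ e → trans (cong (x *_) e) (∣⇒*-cofactor 1≤m x∣m))
                     (tuples k xs)))
    non-divisor : ∀ x → ¬ x ∣ m → count-from x ≡ 0
    non-divisor x x∤m = trans (length-filter-map _ (x Vec.∷_) (tuples k xs))
      (cong length (filter-none (λ v → x * vprod v ≟ m) (All.universal x*-≢m (tuples k xs))))
      where
      x*-≢m : ∀ v → ¬ x * vprod v ≡ m
      x*-≢m v e = x∤m (divides (vprod v) (trans (sym e) (*-comm x (vprod v))))

  tupleCount-range : ∀ a k {N m} → 1 ≤ m → m ≤ N →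
    tupleCount (range a N) k m ≡ tupleCount (range a m) k m
  tupleCount-range a zero    _   _   = refl
  tupleCount-range a (suc k) {N} {m} 1≤m m≤N = begin
    tupleCount (range a N) (suc k) m
      ≡⟨ tupleCount-suc (range a N) k 1≤m ⟩
    sum (map (λ x → tupleCount (range a N) k (cofactor m x)) (boundedDivisors a N m))
      ≡⟨ Σ-map-cong-∈ (boundedDivisors a N m) (λ {x} → bound-irrelevant (≤-trans (cofactor-≤ m x) m≤N)) ⟩
    sum (map countᵢ (boundedDivisors a N m))
      ≡⟨ sum-boundedDivisors-bound a countᵢ 1≤m m≤N ⟩
    sum (map countᵢ (boundedDivisors a m m))
      ≡⟨ Σ-map-cong-∈ (boundedDivisors a m m) (λ {x} → sym ∘ bound-irrelevant (cofactor-≤ m x)) ⟩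
    sum (map (λ x → tupleCount (range a m) k (cofactor m x)) (boundedDivisors a m m))
      ≡⟨ sym (tupleCount-suc (range a m) k 1≤m) ⟩
    tupleCount (range a m) (suc k) m
      ∎
    where
    open ≡-Reasoning
    countᵢ : ℕ → ℕ
    countᵢ x = tupleCount (range a (cofactor m x)) k (cofactor m x)
    bound-irrelevant : ∀ {M x} → cofactor m x ≤ M → x ∈ boundedDivisors a M m →
                       tupleCount (range a M) k (cofactor m x) ≡ countᵢ x
    bound-irrelevant {M} q≤M x∈ =
      tupleCount-range a k (cofactor-positive 1≤m (∈-boundedDivisors⇒∣ {a} {M} x∈)) q≤M

  tupleCount-cofactor : ∀ a k {n x} → 1 ≤ n → x ∣ n →
    tupleCount (range a n) k (cofactor n x) ≡ tupleCount (range a (cofactor n x)) k (cofactor n x)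
  tupleCount-cofactor a k {n} {x} 1≤n x∣n = tupleCount-range a k (cofactor-positive 1≤n x∣n) (cofactor-≤ n x)

  d-suc : ∀ k {n} → 1 ≤ n → d (suc k) n ≡ sum (map (d k) (divisors n))
  d-suc k {n} 1≤n = begin
    d (suc k) n
      ≡⟨ tupleCount-suc (range 1 n) k 1≤n ⟩
    sum (map (λ x → tupleCount (range 1 n) k (cofactor n x)) (divisors n))
      ≡⟨ Σ-map-cong-∈ (divisors n) (tupleCount-cofactor 1 k 1≤n ∘ ∈-divisors⁻) ⟩
    sum (map (d k ∘ cofactor n) (divisors n))
      ≡⟨ sum-divisors-cofactor (d k) 1≤n ⟩
    sum (map (d k) (divisors n))
      ∎
    where open ≡-Reasoning

  c-suc : ∀ k {n} → 1 ≤ n → c (suc k) n + c k n ≡ cr k 1 n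
  c-suc k {n@(suc n-1)} 1≤n = begin
    c (suc k) n + c k n
      ≡⟨ +-comm (c (suc k) n) (c k n) ⟩
    c k n + c (suc k) n
      ≡⟨ cong₂ _+_ (cong (c k) (sym (n/1≡n n))) (tupleCount-suc (range 2 n) k 1≤n) ⟩
    c k (cofactor n 1) + sum (map (λ x → tupleCount (range 2 n) k (cofactor n x)) (boundedDivisors 2 n n))
      ≡⟨ cong (c k (cofactor n 1) +_) (Σ-map-cong-∈ (boundedDivisors 2 n n)
           (tupleCount-cofactor 2 k 1≤n ∘ ∈-boundedDivisors⇒∣ {2} {n})) ⟩
    sum (map (c k ∘ cofactor n) (1 ∷ boundedDivisors 2 n n))
      ≡⟨ cong (sum ∘ map (c k ∘ cofactor n)) (sym divisors≡1∷) ⟩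
    sum (map (c k ∘ cofactor n) (divisors n))
      ≡⟨ sum-divisors-cofactor (c k) 1≤n ⟩
    cr k 1 n
      ∎
    where
    open ≡-Reasoning
    divisors≡1∷ : divisors n ≡ 1 ∷ boundedDivisors 2 n n
    divisors≡1∷ = trans (cong (filter (_∣? n)) range-1≡1∷) (filter-accept (_∣? n) (1∣ n))
      where
      range-1≡1∷ : range 1 n ≡ 1 ∷ range 2 n
      range-1≡1∷ = cong (1 ∷_) (trans (map-applyUpTo suc (1 +_) n-1) (sym (map-upTo (2 +_) n-1)))


module PrimePowerDivisors where
  open import Data.Nat.Base
  open import Data.Nat.Properties
  open import Data.Nat.Divisibility using (_∣_; _∣?_; divides; ∣-trans; ∣1⇒≡1; *-pres-∣; *-cancelˡ-∣)
  open import Data.Nat.Primality using (Prime; euclidsLemma; prime⇒irreducible; ¬prime[1]; prime⇒nonZero)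
  open import Data.Nat.Coprimality using (Coprime; coprime-divisor)
  open import Data.Nat.ListAction using (sum)
  open import Data.List.Base using (List; map; concatMap; upTo)
  open import Data.List.Properties using (map-∘; map-cong)
  open import Data.List.Membership.Propositional using (_∈_; find; lose)
  open import Data.List.Membership.Propositional.Properties
    using (∈-map⁺; ∈-map⁻; ∈-upTo⁺; ∈-upTo⁻; ∈-concatMap⁺; ∈-concatMap⁻)
  import Data.List.Relation.Unary.All as All
  import Data.List.Relation.Unary.All.Properties as All
  import Data.List.Relation.Unary.AllPairs.Properties as AllPairs
  open import Data.List.Relation.Unary.Unique.Propositional using (Unique)
  import Data.List.Relation.Unary.Unique.Propositional.Properties as Unique
  open import Data.Product.Base using (_×_; _,_; ∃-syntax)
  open import Data.Sum.Base using (inj₁; inj₂)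
  open import Function.Base using (_∘_)
  open import Relation.Binary.PropositionalEquality
  open import Relation.Nullary using (¬_; yes; no; contradiction)
  open import Defs using (divisors)
  open ℕ-Sums using (Σ-concatMap)
  open FilterCounting using (sum-map-set-equal)
  open Divisors using (divisors-unique; ∈-divisors⁻; ∈-divisors⁺)

  prime∣^⇒≡ : ∀ {p q} → Prime p → Prime q → ∀ b → p ∣ q ^ b → p ≡ q
  prime∣^⇒≡ pp pq zero    p∣1 = contradiction (subst Prime (∣1⇒≡1 p∣1) pp) ¬prime[1]
  prime∣^⇒≡ {q = q} pp pq (suc b) p∣q^[1+b] with euclidsLemma q (q ^ b) pp p∣q^[1+b]
  ... | inj₂ p∣q^b = prime∣^⇒≡ pp pq b p∣q^b
  ... | inj₁ p∣q with prime⇒irreducible pq p∣q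
  ...   | inj₁ p≡1 = contradiction (subst Prime p≡1 pp) ¬prime[1]
  ...   | inj₂ p≡q = p≡q

  prime∤⇒coprime : ∀ {p z} → Prime p → ¬ p ∣ z → Coprime z p
  prime∤⇒coprime pp p∤z (c∣z , c∣p) with prime⇒irreducible pp c∣p
  ... | inj₁ c≡1 = c≡1
  ... | inj₂ refl = contradiction c∣z p∤z

  ^-∣ : ∀ p {e a} → e ≤ a → p ^ e ∣ p ^ a
  ^-∣ p {e} {a} e≤a = divides (p ^ (a ∸ e)) (begin
    p ^ a                  ≡⟨ cong (p ^_) (sym (m+[n∸m]≡n e≤a)) ⟩
    p ^ (e + (a ∸ e))      ≡⟨ ^-distribˡ-+-* p e (a ∸ e) ⟩
    p ^ e * p ^ (a ∸ e)    ≡⟨ *-comm (p ^ e) _ ⟩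
    p ^ (a ∸ e) * p ^ e    ∎)
    where open ≡-Reasoning

  p-adic-unique : ∀ {p y y′} → Prime p → ¬ p ∣ y → ¬ p ∣ y′ →
                  ∀ e e′ → p ^ e * y ≡ p ^ e′ * y′ → e ≡ e′
  p-adic-unique pp p∤y p∤y′ zero    zero     _  = refl
  p-adic-unique {p} {y} {y′} pp p∤y p∤y′ zero (suc e′) eq =
    contradiction (divides (p ^ e′ * y′) (trans (sym (*-identityˡ y))
      (trans eq (trans (*-assoc p (p ^ e′) y′) (*-comm p _))))) p∤y
  p-adic-unique pp p∤y p∤y′ (suc e) zero     eq = sym (p-adic-unique pp p∤y′ p∤y zero (suc e) (sym eq))
  p-adic-unique {p} {y} {y′} pp p∤y p∤y′ (suc e) (suc e′) eq =
    cong suc (p-adic-unique pp p∤y p∤y′ e e′ (*-cancelˡ-≡ _ _ p {{prime⇒nonZero pp}}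
      (trans (sym (*-assoc p (p ^ e) y)) (trans eq (*-assoc p (p ^ e′) y′)))))

  module _ {p m : ℕ} (p-prime : Prime p) (p∤m : ¬ p ∣ m) where
    instance _ = prime⇒nonZero p-prime

    ∣p^a*m⇒ : ∀ a {z} → z ∣ p ^ a * m → ∃[ e ] ∃[ y ] e ≤ a × y ∣ m × z ≡ p ^ e * y
    ∣p^a*m⇒ zero    {z} z∣m = 0 , z , z≤n , subst (z ∣_) (*-identityˡ m) z∣m , sym (*-identityˡ z)
    ∣p^a*m⇒ (suc a) {z} z∣p^[1+a]*m with p Data.Nat.Divisibility.∣? z
    ... | yes (divides q refl) =
      let q∣p^a*m = *-cancelˡ-∣ p (subst₂ _∣_ (*-comm q p) (*-assoc p (p ^ a) m) z∣p^[1+a]*m)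
          (e , y , e≤a , y∣m , q≡) = ∣p^a*m⇒ a q∣p^a*m
      in suc e , y , s≤s e≤a , y∣m ,
         trans (cong (_* p) q≡) (trans (*-comm (p ^ e * y) p) (sym (*-assoc p (p ^ e) y)))
    ... | no p∤z =
      let (e , y , e≤a , y∣m , z≡) = ∣p^a*m⇒ a
            (coprime-divisor (prime∤⇒coprime p-prime p∤z) (subst (z ∣_) (*-assoc p (p ^ a) m) z∣p^[1+a]*m))
      in e , y , m≤n⇒m≤1+n e≤a , y∣m , z≡

    ∤-divisors : ∀ {y} → y ∈ divisors m → ¬ p ∣ y
    ∤-divisors y∈ p∣y = p∤m (∣-trans p∣y (∈-divisors⁻ y∈))

    module _ (1≤m : 1 ≤ m) where

      scaledDivisors : ℕ → List ℕ
      scaledDivisors e = map (p ^ e *_) (divisors m)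

      divisors-p^a*m : ℕ → List ℕ
      divisors-p^a*m a = concatMap scaledDivisors (upTo (suc a))

      divisors-p^a*m-unique : ∀ a → Unique (divisors-p^a*m a)
      divisors-p^a*m-unique a = Unique.concat⁺
        (All.map⁺ (All.universal scaled-unique (upTo (suc a))))
        (AllPairs.map⁺ (AllPairs.applyUpTo⁺₁ (λ e → e) (suc a) (λ e<e′ _ → disjoint e<e′)))
        where
        scaled-unique : ∀ e → Unique (scaledDivisors e)
        scaled-unique e = Unique.map⁺ (*-cancelˡ-≡ _ _ (p ^ e) {{m^n≢0 p e}}) (divisors-unique m)
        disjoint : ∀ {e e′} → e < e′ → ∀ {z} → ¬ (z ∈ scaledDivisors e × z ∈ scaledDivisors e′)
        disjoint {e} {e′} e<e′ (z∈ , z∈′) with ∈-map⁻ (p ^ e *_) z∈ | ∈-map⁻ (p ^ e′ *_) z∈′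
        ... | y , y∈ , refl | y′ , y′∈ , eq =
          <⇒≢ e<e′ (p-adic-unique p-prime (∤-divisors y∈) (∤-divisors y′∈) e e′ eq)

      sum-divisors-p^a*m : ∀ a (g : ℕ → ℕ) → sum (map g (divisors (p ^ a * m)))
                           ≡ sum (map (λ e → sum (map (λ y → g (p ^ e * y)) (divisors m))) (upTo (suc a)))
      sum-divisors-p^a*m a g = begin
        sum (map g (divisors (p ^ a * m)))
          ≡⟨ sum-map-set-equal g (divisors-unique (p ^ a * m)) (divisors-p^a*m-unique a) split join ⟩
        sum (map g (divisors-p^a*m a))
          ≡⟨ Σ-concatMap g scaledDivisors (upTo (suc a)) ⟩
        sum (map (λ e → sum (map g (scaledDivisors e))) (upTo (suc a)))
          ≡⟨ cong sum (map-cong (λ e → cong sum (sym (map-∘ (divisors m)))) (upTo (suc a))) ⟩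
        sum (map (λ e → sum (map (λ y → g (p ^ e * y)) (divisors m))) (upTo (suc a)))
          ∎
        where
        open ≡-Reasoning
        1≤p^a*m : 1 ≤ p ^ a * m
        1≤p^a*m = *-mono-≤ (m^n>0 p a) 1≤m
        split : ∀ {z} → z ∈ divisors (p ^ a * m) → z ∈ divisors-p^a*m a
        split z∈ with ∣p^a*m⇒ a (∈-divisors⁻ z∈)
        ... | e , y , e≤a , y∣m , refl =
          ∈-concatMap⁺ scaledDivisors
            (lose (∈-upTo⁺ (s≤s e≤a)) (∈-map⁺ (p ^ e *_) (∈-divisors⁺ 1≤m y∣m)))
        join : ∀ {z} → z ∈ divisors-p^a*m a → z ∈ divisors (p ^ a * m)
        join z∈ with find (∈-concatMap⁻ scaledDivisors {xs = upTo (suc a)} z∈)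
        ... | e , e∈ , z∈′ with ∈-map⁻ (p ^ e *_) z∈′
        ... | y , y∈ , refl =
          ∈-divisors⁺ 1≤p^a*m (*-pres-∣ (^-∣ p (≤-pred (∈-upTo⁻ e∈))) (∈-divisors⁻ y∈))


module DivisorFunction where
  open import Data.Nat.Base
  open import Data.Nat.Properties
  open import Data.Nat.Combinatorics using (_C_; nCn≡1; k>n⇒nCk≡0)
  open import Data.Nat.Divisibility using (_∣_; ∣1⇒≡1)
  open import Data.Nat.Primality using (Prime; euclidsLemma; ¬prime[1]; prime⇒nonZero)
  open import Data.Nat.ListAction using (sum; product)
  open import Data.List.Base using (List; []; _∷_; map; upTo; length)
  open import Data.List.Properties using (map-cong; filter-reject)
  open import Data.List.Membership.Propositional using (_∈_)
  open import Data.List.Relation.Unary.All using (All; []; _∷_)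
  open import Data.List.Relation.Unary.AllPairs using (_∷_)
  open import Data.List.Relation.Unary.Unique.Propositional using (Unique)
  import Data.Vec.Base as Vec
  open import Data.Product.Base using (_×_; _,_; proj₁; proj₂)
  open import Data.Sum.Base using (inj₁; inj₂)
  open import Function.Base using (_∘_)
  open import Relation.Binary.PropositionalEquality
  open import Relation.Nullary using (¬_; contradiction)
  open import Defs using (d; divisors; vprod)
  open ℕ-Sums using (Σ-map-*ˡ; Σ-map-*ʳ; Σ-map-cong-∈; Σ-upTo-suc; Σ-map-0)
  open Binomial using (C-trinomial; C-hockey-stick)
  open Divisors using (∈-divisors⁻; ∣⇒positive)
  open TupleCounting using (d-suc)
  open PrimePowerDivisors using (prime∣^⇒≡; ∤-divisors; sum-divisors-p^a*m)

  -- d_k(p^a): the exponent a is distributed over k ordered factors.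
  d-pow : ℕ → ℕ → ℕ
  d-pow k a = (a + k ∸ 1) C a

  sum-d-pow : ∀ k a → sum (map (d-pow k) (upTo (suc a))) ≡ d-pow (suc k) a
  sum-d-pow zero a = begin
    sum (map (d-pow 0) (upTo (suc a)))
      ≡⟨ Σ-upTo-suc (d-pow 0) a ⟩
    1 + sum (map (d-pow 0 ∘ suc) (upTo a))
      ≡⟨ cong (1 +_) (trans (cong sum (map-cong d-pow-0-suc (upTo a))) (Σ-map-0 (upTo a))) ⟩
    1
      ≡⟨ sym (nCn≡1 a) ⟩
    a C a
      ≡⟨ cong (_C a) (sym (m+n∸n≡m a 1)) ⟩
    d-pow 1 a
      ∎
    where
    open ≡-Reasoning
    d-pow-0-suc : ∀ e → d-pow 0 (suc e) ≡ 0
    d-pow-0-suc e = k>n⇒nCk≡0 (s≤s (≤-reflexive (+-identityʳ e)))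
  sum-d-pow (suc k) a = begin
    sum (map (d-pow (suc k)) (upTo (suc a)))
      ≡⟨ cong sum (map-cong (λ e → cong (λ n → (n ∸ 1) C e) (+-suc e k)) (upTo (suc a))) ⟩
    sum (map (λ e → (e + k) C e) (upTo (suc a)))
      ≡⟨ C-hockey-stick k a ⟩
    suc (a + k) C a
      ≡⟨ cong (_C a) (sym (+-suc a k)) ⟩
    (a + suc k) C a
      ≡⟨ cong (λ n → (n ∸ 1) C a) (sym (+-suc a (suc k))) ⟩
    d-pow (suc (suc k)) a
      ∎
    where
    open ≡-Reasoning

  d-zero-≢1 : ∀ {n} → n ≢ 1 → d 0 n ≡ 0
  d-zero-≢1 {n} n≢1 = cong length (filter-reject (λ v → vprod v ≟ n) {x = Vec.[]} {xs = []} (n≢1 ∘ sym))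

  d-one : ∀ k → d k 1 ≡ 1
  d-one zero    = refl
  d-one (suc k) = trans (d-suc k (s≤s z≤n)) (cong (_+ 0) (d-one k))

  d-p^a*m : ∀ k a {p m} → Prime p → ¬ p ∣ m → 1 ≤ m → d k (p ^ a * m) ≡ d-pow k a * d k m
  d-p^a*m zero zero    {p} {m} _ _ _ = trans (cong (d 0) (*-identityˡ m)) (sym (*-identityˡ (d 0 m)))
  d-p^a*m zero (suc a) {p} {m} pp _ _ = trans (d-zero-≢1 p^[1+a]*m≢1)
    (sym (cong (_* d 0 m) (k>n⇒nCk≡0 (s≤s (≤-reflexive (+-identityʳ a))))))
    where
    p^[1+a]*m≢1 : p ^ suc a * m ≢ 1
    p^[1+a]*m≢1 eq = ¬prime[1] (subst Prime (m*n≡1⇒m≡1 p (p ^ a) (m*n≡1⇒m≡1 (p ^ suc a) m eq)) pp)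
  d-p^a*m (suc k) a {p} {m} pp p∤m 1≤m = begin
    d (suc k) (p ^ a * m)
      ≡⟨ d-suc k (*-mono-≤ (m^n>0 p {{prime⇒nonZero pp}} a) 1≤m) ⟩
    sum (map (d k) (divisors (p ^ a * m)))
      ≡⟨ sum-divisors-p^a*m pp p∤m 1≤m a (d k) ⟩
    sum (map (λ e → sum (map (λ y → d k (p ^ e * y)) (divisors m))) (upTo (suc a)))
      ≡⟨ cong sum (map-cong (λ e → Σ-map-cong-∈ (divisors m) (ih e)) (upTo (suc a))) ⟩
    sum (map (λ e → sum (map (λ y → d-pow k e * d k y) (divisors m))) (upTo (suc a)))
      ≡⟨ cong sum (map-cong (λ e → Σ-map-*ˡ (d-pow k e) (d k) (divisors m)) (upTo (suc a))) ⟩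
    sum (map (λ e → d-pow k e * sum (map (d k) (divisors m))) (upTo (suc a)))
      ≡⟨ Σ-map-*ʳ (sum (map (d k) (divisors m))) (d-pow k) (upTo (suc a)) ⟩
    sum (map (d-pow k) (upTo (suc a))) * sum (map (d k) (divisors m))
      ≡⟨ cong₂ _*_ (sum-d-pow k a) (sym (d-suc k 1≤m)) ⟩
    d-pow (suc k) a * d (suc k) m
      ∎
    where
    open ≡-Reasoning
    ih : ∀ e {y} → y ∈ divisors m → d k (p ^ e * y) ≡ d-pow k e * d k y
    ih e y∈ = d-p^a*m k e pp (∤-divisors pp p∤m y∈) (∣⇒positive 1≤m (∈-divisors⁻ y∈))

  value : List (ℕ × ℕ) → ℕ
  value fs = product (map (λ pa → proj₁ pa ^ proj₂ pa) fs)

  value-positive : ∀ fs → All (Prime ∘ proj₁) fs → 1 ≤ value fs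
  value-positive []              []        = s≤s z≤n
  value-positive ((p , a) ∷ fs) (pp ∷ ps) = *-mono-≤ (m^n>0 p {{prime⇒nonZero pp}} a) (value-positive fs ps)

  prime∤value : ∀ {p} fs → Prime p → All (Prime ∘ proj₁) fs → All (p ≢_) (map proj₁ fs) →
                ¬ p ∣ value fs
  prime∤value []              pp []        []          p∣1 =
    contradiction (subst Prime (∣1⇒≡1 p∣1) pp) ¬prime[1]
  prime∤value ((q , b) ∷ fs) pp (pq ∷ ps) (p≢q ∷ p∉) p∣value
    with euclidsLemma (q ^ b) (value fs) pp p∣value
  ... | inj₁ p∣q^b = p≢q (prime∣^⇒≡ pp pq b p∣q^b)
  ... | inj₂ p∣rest = prime∤value fs pp ps p∉ p∣rest

  d-value : ∀ k fs → All (Prime ∘ proj₁) fs → Unique (map proj₁ fs) →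
            d k (value fs) ≡ product (map (d-pow k) (map proj₂ fs))
  d-value k []              _         _          = d-one k
  d-value k ((p , a) ∷ fs) (pp ∷ ps) (p∉ ∷ uniq) = trans
    (d-p^a*m k a pp (prime∤value fs pp ps p∉) (value-positive fs ps))
    (cong (d-pow k a *_) (d-value k fs ps uniq))

  +suc∸1 : ∀ m n → m + suc n ∸ 1 ≡ m + n
  +suc∸1 m n = cong (_∸ 1) (+-suc m n)

  d-pow-shift : ∀ a i u → d-pow (suc u) a * ((a + i + u) C i) ≡ ((i + u) C i) * d-pow (suc (i + u)) a
  d-pow-shift a i u = begin
    ((a + suc u ∸ 1) C a) * ((a + i + u) C i)
      ≡⟨ cong (λ n → (n C a) * ((a + i + u) C i)) (+suc∸1 a u) ⟩
    ((a + u) C a) * ((a + i + u) C i)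
      ≡⟨ *-comm ((a + u) C a) _ ⟩
    ((a + i + u) C i) * ((a + u) C a)
      ≡⟨ sym (C-trinomial a i u) ⟩
    ((a + i + u) C a) * ((i + u) C i)
      ≡⟨ *-comm ((a + i + u) C a) _ ⟩
    ((i + u) C i) * ((a + i + u) C a)
      ≡⟨ cong (λ n → ((i + u) C i) * (n C a)) (trans (+-assoc a i u) (sym (+suc∸1 a (i + u)))) ⟩
    ((i + u) C i) * ((a + suc (i + u) ∸ 1) C a)
      ∎
    where open ≡-Reasoning

  d-pow-ratio₁ : ∀ {a j i} r → 1 ≤ a → 1 ≤ j → i ≤ j →
    d-pow (j ∸ i + r) a * ((a + j + r ∸ 1) C i) ≡ ((j + r ∸ 1) C i) * d-pow (j + r) a
  d-pow-ratio₁ {a} {j} {i} r 1≤a 1≤j i≤j with j ∸ i + r in eq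
  ... | suc u = begin
    d-pow (suc u) a * ((a + j + r ∸ 1) C i)
      ≡⟨ cong (λ n → d-pow (suc u) a * (n C i)) a+j+r∸1≡ ⟩
    d-pow (suc u) a * ((a + i + u) C i)
      ≡⟨ d-pow-shift a i u ⟩
    ((i + u) C i) * d-pow (suc (i + u)) a
      ≡⟨ cong₂ (λ m n → (m C i) * d-pow n a) (cong (_∸ 1) (sym j+r≡)) (sym j+r≡) ⟩
    ((j + r ∸ 1) C i) * d-pow (j + r) a
      ∎
    where
    open ≡-Reasoning
    j+r≡ : j + r ≡ suc (i + u)
    j+r≡ = begin
      j + r               ≡⟨ cong (_+ r) (sym (m+[n∸m]≡n i≤j)) ⟩
      i + (j ∸ i) + r     ≡⟨ +-assoc i (j ∸ i) r ⟩
      i + (j ∸ i + r)     ≡⟨ cong (i +_) eq ⟩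
      i + suc u           ≡⟨ +-suc i u ⟩
      suc (i + u)         ∎
    a+j+r∸1≡ : a + j + r ∸ 1 ≡ a + i + u
    a+j+r∸1≡ = begin
      a + j + r ∸ 1       ≡⟨ cong (_∸ 1) (+-assoc a j r) ⟩
      a + (j + r) ∸ 1     ≡⟨ cong (λ n → a + n ∸ 1) j+r≡ ⟩
      a + suc (i + u) ∸ 1 ≡⟨ +suc∸1 a (i + u) ⟩
      a + (i + u)         ≡⟨ sym (+-assoc a i u) ⟩
      a + i + u           ∎
  d-pow-ratio₁ {suc a} {suc j} {i} r _ _ _ | zero = begin
    d-pow 0 (suc a) * ((suc a + suc j + r ∸ 1) C i)
      ≡⟨ cong (_* ((suc a + suc j + r ∸ 1) C i)) (k>n⇒nCk≡0 (s≤s (≤-reflexive (+-identityʳ a)))) ⟩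
    0
      ≡⟨ sym (cong (_* d-pow (suc j + r) (suc a)) (k>n⇒nCk≡0 j+r∸1<i)) ⟩
    ((suc j + r ∸ 1) C i) * d-pow (suc j + r) (suc a)
      ∎
    where
    open ≡-Reasoning
    -- Here r = 0 and i = j, so both sides vanish.
    r≡0 : r ≡ 0
    r≡0 = m+n≡0⇒n≡0 (suc j ∸ i) eq
    j+r∸1<i : suc j + r ∸ 1 < i
    j+r∸1<i rewrite r≡0 | +-identityʳ j = m∸n≡0⇒m≤n (m+n≡0⇒m≡0 (suc j ∸ i) eq)

  d-pow-ratio₂ : ∀ a i R →
    d-pow (i + suc R) a * ((i + suc R ∸ 1) C i) ≡ ((a + i + suc R ∸ 1) C i) * d-pow (suc R) a
  d-pow-ratio₂ a i R = begin
    d-pow (i + suc R) a * ((i + suc R ∸ 1) C i)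
      ≡⟨ cong₂ (λ m n → (m C a) * (n C i)) a+i+R≡ (+suc∸1 i R) ⟩
    ((a + i + R) C a) * ((i + R) C i)
      ≡⟨ C-trinomial a i R ⟩
    ((a + i + R) C i) * ((a + R) C a)
      ≡⟨ cong₂ (λ m n → (m C i) * (n C a)) (sym (+suc∸1 (a + i) R)) (sym (+suc∸1 a R)) ⟩
    ((a + i + suc R ∸ 1) C i) * d-pow (suc R) a
      ∎
    where
    open ≡-Reasoning
    a+i+R≡ : a + (i + suc R) ∸ 1 ≡ a + i + R
    a+i+R≡ = trans (cong (λ n → a + n ∸ 1) (+-suc i R)) (trans (+suc∸1 a (i + R)) (sym (+-assoc a i R)))


module Rationals where
  open import Data.Nat.Base as ℕ using (ℕ; zero; suc)
  import Data.Nat.Properties as ℕ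
  open import Data.Integer.Base as ℤ using (ℤ; +_; -[1+_])
  import Data.Integer.Properties as ℤ
  open import Data.Rational.Base
  open import Data.Rational.Properties
  open import Data.Rational.Solver using (module +-*-Solver)
  open import Data.Nat.Coprimality using (1-coprimeTo; sym)
  open import Data.Nat.ListAction using (sum; product)
  open import Data.List.Base using (List; []; _∷_; _++_; map; length)
  open import Function.Base using (_∘_)
  open import Relation.Binary.PropositionalEquality hiding (sym)
  import Relation.Binary.PropositionalEquality as ≡
  open import Relation.Nullary using (contradiction)
  open import Defs using (ℕtoℚ; ℤtoℚ; sgn; prodℚ; copies)
  open ℚ-Sums using (Σ)
  open +-*-Solver

  ℤtoℚ≡mkℚ : ∀ z → ℤtoℚ z ≡ mkℚ z 0 (sym (1-coprimeTo _))
  ℤtoℚ≡mkℚ z = ↥p/↧p≡p (mkℚ z 0 _)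

  ℤtoℚ-+ : ∀ x y → ℤtoℚ (x ℤ.+ y) ≡ ℤtoℚ x + ℤtoℚ y
  ℤtoℚ-+ x y rewrite ℤtoℚ≡mkℚ x | ℤtoℚ≡mkℚ y =
    /-cong (cong₂ ℤ._+_ (≡.sym (ℤ.*-identityʳ x)) (≡.sym (ℤ.*-identityʳ y))) refl

  ℤtoℚ-* : ∀ x y → ℤtoℚ (x ℤ.* y) ≡ ℤtoℚ x * ℤtoℚ y
  ℤtoℚ-* x y rewrite ℤtoℚ≡mkℚ x | ℤtoℚ≡mkℚ y = refl

  ℤtoℚ-neg : ∀ x → ℤtoℚ (ℤ.- x) ≡ - ℤtoℚ x
  ℤtoℚ-neg x rewrite ℤtoℚ≡mkℚ x | ℤtoℚ≡mkℚ (ℤ.- x) with x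
  ... | + zero   = refl
  ... | + suc _  = refl
  ... | -[1+ _ ] = refl

  ℕtoℚ-+ : ∀ m n → ℕtoℚ (m ℕ.+ n) ≡ ℕtoℚ m + ℕtoℚ n
  ℕtoℚ-+ m n = trans (cong ℤtoℚ (ℤ.pos-+ m n)) (ℤtoℚ-+ (+ m) (+ n))

  ℕtoℚ-* : ∀ m n → ℕtoℚ (m ℕ.* n) ≡ ℕtoℚ m * ℕtoℚ n
  ℕtoℚ-* m n = trans (cong ℤtoℚ (ℤ.pos-* m n)) (ℤtoℚ-* (+ m) (+ n))

  ℕtoℚ-sum : ∀ {A : Set} (f : A → ℕ) xs → ℕtoℚ (sum (map f xs)) ≡ Σ (map (ℕtoℚ ∘ f) xs)
  ℕtoℚ-sum f []       = refl
  ℕtoℚ-sum f (x ∷ xs) = trans (ℕtoℚ-+ (f x) _) (cong (_+_ (ℕtoℚ (f x))) (ℕtoℚ-sum f xs))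

  ℕtoℚ-product : ∀ {A : Set} (f : A → ℕ) xs → ℕtoℚ (product (map f xs)) ≡ prodℚ (map (ℕtoℚ ∘ f) xs)
  ℕtoℚ-product f []       = refl
  ℕtoℚ-product f (x ∷ xs) = trans (ℕtoℚ-* (f x) _) (cong (ℕtoℚ (f x) *_) (ℕtoℚ-product f xs))

  ℕtoℚ≢0 : ∀ {n} → n ≢ 0 → ℕtoℚ n ≢ 0ℚ
  ℕtoℚ≢0 {n} n≢0 eq = n≢0 (ℤ.+-injective (cong ↥_ (trans (≡.sym (ℤtoℚ≡mkℚ (+ n))) eq)))

  Σ-map-neg : ∀ {A : Set} (f : A → ℚ) xs → Σ (map (λ x → - f x) xs) ≡ - Σ (map f xs)
  Σ-map-neg f []       = refl
  Σ-map-neg f (x ∷ xs) = trans (cong (_+_ (- f x)) (Σ-map-neg f xs)) (≡.sym (neg-distrib-+ (f x) _))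

  prodℚ-++ : ∀ xs ys → prodℚ (xs ++ ys) ≡ prodℚ xs * prodℚ ys
  prodℚ-++ []       ys = ≡.sym (*-identityˡ (prodℚ ys))
  prodℚ-++ (x ∷ xs) ys = trans (cong (x *_) (prodℚ-++ xs ys)) (≡.sym (*-assoc x _ _))

  ℕtoℚ-^-length : ∀ {A : Set} c (xs : List A) → ℕtoℚ (c ℕ.^ length xs) ≡ prodℚ (map (λ _ → ℕtoℚ c) xs)
  ℕtoℚ-^-length c []       = refl
  ℕtoℚ-^-length c (x ∷ xs) = trans (ℕtoℚ-* c _) (cong (ℕtoℚ c *_) (ℕtoℚ-^-length c xs))

  prodℚ-copies : ∀ {A B : Set} (f : A → ℚ) x (ys : List B) →
    prodℚ (map f (copies (length ys) x)) ≡ prodℚ (map (λ _ → f x) ys)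
  prodℚ-copies f x []       = refl
  prodℚ-copies f x (y ∷ ys) = cong (f x *_) (prodℚ-copies f x ys)

  sgn-+ : ∀ a b → sgn (a ℕ.+ b) ≡ sgn a * sgn b
  sgn-+ zero    b = ≡.sym (*-identityˡ (sgn b))
  sgn-+ (suc a) b = trans (cong -_ (sgn-+ a b)) (neg-distribˡ-* (sgn a) (sgn b))

  sgn-square : ∀ a → sgn a * sgn a ≡ 1ℚ
  sgn-square zero    = refl
  sgn-square (suc a) = trans (solve 1 (λ s → :- s :* :- s := s :* s) refl (sgn a)) (sgn-square a)

  sgn≢0 : ∀ a → sgn a ≢ 0ℚ
  sgn≢0 a eq = contradiction (trans (≡.sym (sgn-square a)) (trans (cong (_* sgn a) eq) (*-zeroˡ (sgn a)))) λ ()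

  sgn-∸ : ∀ {i j} → i ℕ.≤ j → sgn j * sgn i ≡ sgn (j ℕ.∸ i)
  sgn-∸ {i} {j} i≤j = begin
    sgn j * sgn i                    ≡⟨ cong (λ n → sgn n * sgn i) (≡.sym (ℕ.m∸n+n≡m i≤j)) ⟩
    sgn (j ℕ.∸ i ℕ.+ i) * sgn i      ≡⟨ cong (_* sgn i) (sgn-+ (j ℕ.∸ i) i) ⟩
    sgn (j ℕ.∸ i) * sgn i * sgn i    ≡⟨ *-assoc (sgn (j ℕ.∸ i)) (sgn i) (sgn i) ⟩
    sgn (j ℕ.∸ i) * (sgn i * sgn i)  ≡⟨ cong (sgn (j ℕ.∸ i) *_) (sgn-square i) ⟩
    sgn (j ℕ.∸ i) * 1ℚ               ≡⟨ *-identityʳ _ ⟩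
    sgn (j ℕ.∸ i)                    ∎
    where open ≡-Reasoning


module TotalDivision where
  open import Data.Nat.Base as ℕ using (ℕ)
  open import Data.Rational.Base
  open import Data.Rational.Properties
  open import Data.Rational.Solver using (module +-*-Solver)
  open import Data.List.Base using ([]; _∷_; map)
  open import Data.List.Properties using (map-cong)
  open import Relation.Binary.PropositionalEquality
  open import Relation.Nullary using (Dec; yes; no; contradiction)
  open import Defs using (ℕtoℚ; prodℚ; _÷₀_)
  open ℚ-Sums using (Σ; Σ-map-*ʳ)
  open Rationals using (ℕtoℚ-*; ℕtoℚ≢0)
  open +-*-Solver

  private
    interchange : ∀ a b c d → (a * b) * (c * d) ≡ (a * c) * (b * d)
    interchange a b c d = solve 4 (λ a b c d → (a :* b) :* (c :* d) := (a :* c) :* (b :* d)) refl a b c d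

  *≢0 : ∀ {p q} → p ≢ 0ℚ → q ≢ 0ℚ → p * q ≢ 0ℚ
  *≢0 {p} {q} p≢0 q≢0 pq≡0 = q≢0 (begin
    q                   ≡⟨ sym (*-identityˡ q) ⟩
    1ℚ * q              ≡⟨ cong (_* q) (sym (*-inverseˡ p)) ⟩
    (1/ p) * p * q      ≡⟨ *-assoc (1/ p) p q ⟩
    (1/ p) * (p * q)    ≡⟨ cong ((1/ p) *_) pq≡0 ⟩
    (1/ p) * 0ℚ         ≡⟨ *-zeroʳ (1/ p) ⟩
    0ℚ                  ∎)
    where
    open ≡-Reasoning
    instance _ = ≢-nonZero p≢0

  ÷₀≡*1÷₀ : ∀ p q → p ÷₀ q ≡ p * (1ℚ ÷₀ q)
  ÷₀≡*1÷₀ p q with q ≟ 0ℚ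
  ... | yes _ = sym (*-zeroʳ p)
  ... | no  _ = cong (p *_) (sym (*-identityˡ _))

  *-1÷₀ : ∀ {q} → q ≢ 0ℚ → q * (1ℚ ÷₀ q) ≡ 1ℚ
  *-1÷₀ {q} q≢0 with q ≟ 0ℚ
  ... | yes q≡0  = contradiction q≡0 q≢0
  ... | no  q≢0′ = trans (cong (q *_) (*-identityˡ _)) (*-inverseʳ q {{≢-nonZero q≢0′}})

  -- Case analysis through a local function: a with-abstraction over p ≟ 0ℚ would also rewrite
  -- the occurrences of 1ℚ ÷₀ p in the goal.
  1÷₀-* : ∀ p q → 1ℚ ÷₀ (p * q) ≡ (1ℚ ÷₀ p) * (1ℚ ÷₀ q)
  1÷₀-* p q = cases (p ≟ 0ℚ) (q ≟ 0ℚ)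
    where
    open ≡-Reasoning
    r = 1ℚ ÷₀ (p * q)
    p⁻¹ = 1ℚ ÷₀ p
    q⁻¹ = 1ℚ ÷₀ q
    cases : Dec (p ≡ 0ℚ) → Dec (q ≡ 0ℚ) → r ≡ p⁻¹ * q⁻¹
    cases (yes refl) _          = trans (cong (1ℚ ÷₀_) (*-zeroˡ q)) (sym (*-zeroˡ q⁻¹))
    cases (no _)     (yes refl) = trans (cong (1ℚ ÷₀_) (*-zeroʳ p)) (sym (*-zeroʳ p⁻¹))
    cases (no p≢0)   (no q≢0)   = begin
      r
        ≡⟨ sym (*-identityʳ r) ⟩
      r * 1ℚ
        ≡⟨ cong (r *_) (sym (trans (cong₂ _*_ (*-1÷₀ p≢0) (*-1÷₀ q≢0)) (*-identityˡ 1ℚ))) ⟩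
      r * ((p * p⁻¹) * (q * q⁻¹))
        ≡⟨ solve 5 (λ r p q a b → r :* ((p :* a) :* (q :* b)) := ((p :* q) :* r) :* (a :* b))
                   refl r p q p⁻¹ q⁻¹ ⟩
      ((p * q) * r) * (p⁻¹ * q⁻¹)
        ≡⟨ cong (_* (p⁻¹ * q⁻¹)) (*-1÷₀ (*≢0 p≢0 q≢0)) ⟩
      1ℚ * (p⁻¹ * q⁻¹)
        ≡⟨ *-identityˡ _ ⟩
      p⁻¹ * q⁻¹
        ∎

  ÷₀-* : ∀ p p′ q q′ → (p * p′) ÷₀ (q * q′) ≡ (p ÷₀ q) * (p′ ÷₀ q′)
  ÷₀-* p p′ q q′ = begin
    (p * p′) ÷₀ (q * q′)
      ≡⟨ ÷₀≡*1÷₀ (p * p′) (q * q′) ⟩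
    (p * p′) * (1ℚ ÷₀ (q * q′))
      ≡⟨ cong ((p * p′) *_) (1÷₀-* q q′) ⟩
    (p * p′) * ((1ℚ ÷₀ q) * (1ℚ ÷₀ q′))
      ≡⟨ interchange p p′ (1ℚ ÷₀ q) (1ℚ ÷₀ q′) ⟩
    (p * (1ℚ ÷₀ q)) * (p′ * (1ℚ ÷₀ q′))
      ≡⟨ sym (cong₂ _*_ (÷₀≡*1÷₀ p q) (÷₀≡*1÷₀ p′ q′)) ⟩
    (p ÷₀ q) * (p′ ÷₀ q′)
      ∎
    where open ≡-Reasoning

  ÷₀-1 : ∀ p → p ÷₀ 1ℚ ≡ p
  ÷₀-1 p = trans (÷₀≡*1÷₀ p 1ℚ) (*-identityʳ p)

  *-÷₀ : ∀ c p q → c * (p ÷₀ q) ≡ (c * p) ÷₀ q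
  *-÷₀ c p q = begin
    c * (p ÷₀ q)          ≡⟨ cong (_* (p ÷₀ q)) (sym (÷₀-1 c)) ⟩
    (c ÷₀ 1ℚ) * (p ÷₀ q)  ≡⟨ sym (÷₀-* c p 1ℚ q) ⟩
    (c * p) ÷₀ (1ℚ * q)   ≡⟨ cong ((c * p) ÷₀_) (*-identityˡ q) ⟩
    (c * p) ÷₀ q          ∎
    where open ≡-Reasoning

  ÷₀-cancelˡ : ∀ {c} p q → c ≢ 0ℚ → (c * p) ÷₀ (c * q) ≡ p ÷₀ q
  ÷₀-cancelˡ {c} p q c≢0 = begin
    (c * p) ÷₀ (c * q)   ≡⟨ ÷₀-* c p c q ⟩
    (c ÷₀ c) * (p ÷₀ q)  ≡⟨ cong (_* (p ÷₀ q)) (trans (÷₀≡*1÷₀ c c) (*-1÷₀ c≢0)) ⟩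
    1ℚ * (p ÷₀ q)        ≡⟨ *-identityˡ _ ⟩
    p ÷₀ q               ∎
    where open ≡-Reasoning

  ÷₀-cross : ∀ {p p′ q q′} → q ≢ 0ℚ → q′ ≢ 0ℚ → p * q′ ≡ p′ * q → p ÷₀ q ≡ p′ ÷₀ q′
  ÷₀-cross {p} {p′} {q} {q′} q≢0 q′≢0 eq = begin
    p ÷₀ q                       ≡⟨ sym (*-identityʳ _) ⟩
    (p ÷₀ q) * 1ℚ                ≡⟨ cong ((p ÷₀ q) *_) (sym (*-1÷₀ q′≢0)) ⟩
    (p ÷₀ q) * (q′ * q′⁻¹)       ≡⟨ cong (_* (q′ * q′⁻¹)) (÷₀≡*1÷₀ p q) ⟩
    (p * q⁻¹) * (q′ * q′⁻¹)      ≡⟨ interchange p q⁻¹ q′ q′⁻¹ ⟩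
    (p * q′) * (q⁻¹ * q′⁻¹)      ≡⟨ cong (_* (q⁻¹ * q′⁻¹)) eq ⟩
    (p′ * q) * (q⁻¹ * q′⁻¹)      ≡⟨ shuffle′ p′ q q⁻¹ q′⁻¹ ⟩
    (q * q⁻¹) * (p′ * q′⁻¹)      ≡⟨ cong₂ _*_ (*-1÷₀ q≢0) (sym (÷₀≡*1÷₀ p′ q′)) ⟩
    1ℚ * (p′ ÷₀ q′)              ≡⟨ *-identityˡ _ ⟩
    p′ ÷₀ q′                     ∎
    where
    open ≡-Reasoning
    q⁻¹ = 1ℚ ÷₀ q
    q′⁻¹ = 1ℚ ÷₀ q′
    shuffle′ : ∀ a b c d → (a * b) * (c * d) ≡ (b * c) * (a * d)
    shuffle′ a b c d = solve 4 (λ a b c d → (a :* b) :* (c :* d) := (b :* c) :* (a :* d)) refl a b c d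

  infixl 7 _÷ℕ_
  _÷ℕ_ : ℕ → ℕ → ℚ
  p ÷ℕ q = ℕtoℚ p ÷₀ ℕtoℚ q

  ÷ℕ-cross : ∀ {p p′ q q′} → q ≢ 0 → q′ ≢ 0 → p ℕ.* q′ ≡ p′ ℕ.* q →
             p ÷ℕ q ≡ p′ ÷ℕ q′
  ÷ℕ-cross {p} {p′} {q} {q′} q≢0 q′≢0 eq = ÷₀-cross (ℕtoℚ≢0 q≢0) (ℕtoℚ≢0 q′≢0)
    (trans (sym (ℕtoℚ-* p q′)) (trans (cong ℕtoℚ eq) (ℕtoℚ-* p′ q)))

  prodℚ-map-÷₀ : ∀ {A : Set} (f g : A → ℚ) xs →
                 prodℚ (map (λ x → f x ÷₀ g x) xs) ≡ prodℚ (map f xs) ÷₀ prodℚ (map g xs)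
  prodℚ-map-÷₀ f g []       = sym (÷₀-1 1ℚ)
  prodℚ-map-÷₀ f g (x ∷ xs) =
    trans (cong ((f x ÷₀ g x) *_) (prodℚ-map-÷₀ f g xs)) (sym (÷₀-* (f x) _ (g x) _))

  Σ-map-÷₀ : ∀ {A : Set} (f : A → ℚ) xs q → Σ (map (λ x → f x ÷₀ q) xs) ≡ Σ (map f xs) ÷₀ q
  Σ-map-÷₀ f xs q = begin
    Σ (map (λ x → f x ÷₀ q) xs)          ≡⟨ cong Σ (map-cong (λ x → ÷₀≡*1÷₀ (f x) q) xs) ⟩
    Σ (map (λ x → f x * (1ℚ ÷₀ q)) xs)   ≡⟨ Σ-map-*ʳ (1ℚ ÷₀ q) f xs ⟩
    Σ (map f xs) * (1ℚ ÷₀ q)             ≡⟨ sym (÷₀≡*1÷₀ _ q) ⟩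
    Σ (map f xs) ÷₀ q                    ∎
    where open ≡-Reasoning


module RisingFactorial where
  open import Data.Nat.Base as ℕ using (ℕ; zero; suc; _!)
  import Data.Nat.Properties as ℕ
  open import Data.Nat.Combinatorics using (_C_)
  open import Data.Integer.Base as ℤ using (ℤ; +_; -[1+_])
  import Data.Integer.Properties as ℤ
  open import Data.Integer.Tactic.RingSolver using (solve-∀)
  open import Data.Rational.Base using (ℚ; 0ℚ; 1ℚ; _*_; -_)
  import Data.Rational.Properties as ℚ
  open import Data.Rational.Solver using (module +-*-Solver)
  open import Relation.Binary.PropositionalEquality
  open import Defs using (rising; ℕtoℚ; ℤtoℚ; sgn; _÷₀_)
  open Binomial using (C-absorb)
  open Rationals using (ℤtoℚ-*; ℤtoℚ-neg; ℕtoℚ-*; ℕtoℚ≢0; sgn≢0)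
  open TotalDivision using (_÷ℕ_; *≢0; ÷₀-cancelˡ; ÷₀-1)
  open +-*-Solver

  rising-suc : ∀ a m → rising a (suc m) ≡ a ℤ.* rising (+ 1 ℤ.+ a) m
  rising-suc a zero    = base a
    where
    base : ∀ a → + 1 ℤ.* (a ℤ.+ + 0) ≡ a ℤ.* + 1
    base = solve-∀
  rising-suc a (suc m) =
    trans (cong (ℤ._* (a ℤ.+ + suc m)) (rising-suc a m)) (shuffle a (rising (+ 1 ℤ.+ a) m) (+ m))
    where
    shuffle : ∀ a r n → a ℤ.* r ℤ.* (a ℤ.+ (+ 1 ℤ.+ n)) ≡ a ℤ.* (r ℤ.* (+ 1 ℤ.+ a ℤ.+ n))
    shuffle = solve-∀

  1-[1+x]≡-x : ∀ x → + 1 ℤ.- + suc x ≡ ℤ.- + x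
  1-[1+x]≡-x zero    = refl
  1-[1+x]≡-x (suc x) = refl

  rising-neg : ∀ x m → ℤtoℚ (rising (ℤ.- + x) m) ≡ sgn m * ℕtoℚ (m ! ℕ.* (x C m))
  rising-neg x       zero    = refl
  rising-neg zero    (suc m) = begin
    ℤtoℚ (rising (+ 0) (suc m))
      ≡⟨ cong ℤtoℚ (trans (rising-suc (+ 0) m) (ℤ.*-zeroˡ (rising (+ 1 ℤ.+ + 0) m))) ⟩
    ℤtoℚ (+ 0)
      ≡⟨ sym (ℚ.*-zeroʳ (sgn (suc m))) ⟩
    sgn (suc m) * ℤtoℚ (+ 0)
      ≡⟨ cong (λ n → sgn (suc m) * ℕtoℚ n) (sym (ℕ.*-zeroʳ (suc m !))) ⟩
    sgn (suc m) * ℕtoℚ (suc m ! ℕ.* (0 C suc m))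
      ∎
    where open ≡-Reasoning
  rising-neg (suc x) (suc m) = begin
    ℤtoℚ (rising -[1+ x ] (suc m))
      ≡⟨ cong ℤtoℚ (rising-suc -[1+ x ] m) ⟩
    ℤtoℚ (-[1+ x ] ℤ.* rising (+ 1 ℤ.- + suc x) m)
      ≡⟨ ℤtoℚ-* -[1+ x ] (rising (+ 1 ℤ.- + suc x) m) ⟩
    ℤtoℚ -[1+ x ] * ℤtoℚ (rising (+ 1 ℤ.- + suc x) m)
      ≡⟨ cong₂ _*_ (ℤtoℚ-neg (+ suc x))
                   (trans (cong (λ a → ℤtoℚ (rising a m)) (1-[1+x]≡-x x)) (rising-neg x m)) ⟩
    - ℕtoℚ (suc x) * (sgn m * ℕtoℚ (m ! ℕ.* (x C m)))
      ≡⟨ solve 3 (λ y s c → :- y :* (s :* c) := :- s :* (y :* c)) refl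
                 (ℕtoℚ (suc x)) (sgn m) (ℕtoℚ (m ! ℕ.* (x C m))) ⟩
    - sgn m * (ℕtoℚ (suc x) * ℕtoℚ (m ! ℕ.* (x C m)))
      ≡⟨ cong (- sgn m *_) (sym (ℕtoℚ-* (suc x) (m ! ℕ.* (x C m)))) ⟩
    - sgn m * ℕtoℚ (suc x ℕ.* (m ! ℕ.* (x C m)))
      ≡⟨ cong (λ n → - sgn m * ℕtoℚ n) (sym absorb) ⟩
    sgn (suc m) * ℕtoℚ (suc m ! ℕ.* (suc x C suc m))
      ∎
    where
    open ≡-Reasoning
    absorb : suc m ! ℕ.* (suc x C suc m) ≡ suc x ℕ.* (m ! ℕ.* (x C m))
    absorb = begin
      suc m ℕ.* m ! ℕ.* (suc x C suc m)    ≡⟨ ℕ-shuffle (suc m) (m !) (suc x C suc m) ⟩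
      m ! ℕ.* (suc m ℕ.* (suc x C suc m))  ≡⟨ cong (m ! ℕ.*_) (C-absorb x m) ⟩
      m ! ℕ.* (suc x ℕ.* (x C m))          ≡⟨ ℕ-shuffle′ (m !) (suc x) (x C m) ⟩
      suc x ℕ.* (m ! ℕ.* (x C m))          ∎
      where
      ℕ-shuffle : ∀ a b c → a ℕ.* b ℕ.* c ≡ b ℕ.* (a ℕ.* c)
      ℕ-shuffle a b c = trans (cong (ℕ._* c) (ℕ.*-comm a b)) (ℕ.*-assoc b a c)
      ℕ-shuffle′ : ∀ a b c → a ℕ.* (b ℕ.* c) ≡ b ℕ.* (a ℕ.* c)
      ℕ-shuffle′ a b c = trans (sym (ℕ.*-assoc a b c)) (ℕ-shuffle a b c)

  rising-pos : ∀ y m → ℤtoℚ (rising (+ suc y) m) ≡ ℕtoℚ (m ! ℕ.* ((y ℕ.+ m) C m))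
  rising-pos y zero    = refl
  rising-pos y (suc m) = begin
    ℤtoℚ (rising (+ suc y) m ℤ.* + suc (y ℕ.+ m))
      ≡⟨ ℤtoℚ-* (rising (+ suc y) m) (+ suc (y ℕ.+ m)) ⟩
    ℤtoℚ (rising (+ suc y) m) * ℕtoℚ (suc (y ℕ.+ m))
      ≡⟨ cong (_* ℕtoℚ (suc (y ℕ.+ m))) (rising-pos y m) ⟩
    ℕtoℚ (m ! ℕ.* ((y ℕ.+ m) C m)) * ℕtoℚ (suc (y ℕ.+ m))
      ≡⟨ sym (ℕtoℚ-* (m ! ℕ.* ((y ℕ.+ m) C m)) (suc (y ℕ.+ m))) ⟩
    ℕtoℚ (m ! ℕ.* ((y ℕ.+ m) C m) ℕ.* suc (y ℕ.+ m))
      ≡⟨ cong ℕtoℚ absorb ⟩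
    ℕtoℚ (suc m ! ℕ.* ((y ℕ.+ suc m) C suc m))
      ∎
    where
    open ≡-Reasoning
    absorb : m ! ℕ.* ((y ℕ.+ m) C m) ℕ.* suc (y ℕ.+ m) ≡ suc m ! ℕ.* ((y ℕ.+ suc m) C suc m)
    absorb = begin
      m ! ℕ.* ((y ℕ.+ m) C m) ℕ.* suc (y ℕ.+ m)
        ≡⟨ ℕ.*-assoc (m !) _ _ ⟩
      m ! ℕ.* (((y ℕ.+ m) C m) ℕ.* suc (y ℕ.+ m))
        ≡⟨ cong (m ! ℕ.*_) (trans (ℕ.*-comm _ (suc (y ℕ.+ m))) (sym (C-absorb (y ℕ.+ m) m))) ⟩
      m ! ℕ.* (suc m ℕ.* (suc (y ℕ.+ m) C suc m))
        ≡⟨ sym (ℕ.*-assoc (m !) (suc m) _) ⟩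
      m ! ℕ.* suc m ℕ.* (suc (y ℕ.+ m) C suc m)
        ≡⟨ cong₂ ℕ._*_ (ℕ.*-comm (m !) (suc m)) (cong (_C suc m) (sym (ℕ.+-suc y m))) ⟩
      suc m ! ℕ.* ((y ℕ.+ suc m) C suc m)
        ∎

  module _ (m : ℕ) where
    private
      m!≢0 : ℕtoℚ (m !) ≢ 0ℚ
      m!≢0 = ℕtoℚ≢0 (ℕ.≢-nonZero⁻¹ (m !) {{m ℕ.!≢0}})
      split : ∀ s z → s * ℕtoℚ (m ! ℕ.* z) ≡ s * ℕtoℚ (m !) * ℕtoℚ z
      split s z = trans (cong (s *_) (ℕtoℚ-* (m !) z)) (sym (ℚ.*-assoc s _ _))

    rising-neg-÷₀ : ∀ x y → ℤtoℚ (rising (ℤ.- + x) m) ÷₀ ℤtoℚ (rising (ℤ.- + y) m)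
                          ≡ (x C m) ÷ℕ (y C m)
    rising-neg-÷₀ x y = trans
      (cong₂ _÷₀_ (trans (rising-neg x m) (split (sgn m) (x C m)))
                  (trans (rising-neg y m) (split (sgn m) (y C m))))
      (÷₀-cancelˡ (ℕtoℚ (x C m)) (ℕtoℚ (y C m)) (*≢0 (sgn≢0 m) m!≢0))

    rising-pos-÷₀ : ∀ y z → ℤtoℚ (rising (+ suc y) m) ÷₀ ℤtoℚ (rising (+ suc z) m)
                          ≡ ((y ℕ.+ m) C m) ÷ℕ ((z ℕ.+ m) C m)
    rising-pos-÷₀ y z = trans
      (cong₂ _÷₀_ (trans (rising-pos y m) (ℕtoℚ-* (m !) _)) (trans (rising-pos z m) (ℕtoℚ-* (m !) _)))
      (÷₀-cancelˡ (ℕtoℚ ((y ℕ.+ m) C m)) (ℕtoℚ ((z ℕ.+ m) C m)) m!≢0)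

    rising-neg-÷₀-! : ∀ x → ℤtoℚ (rising (ℤ.- + x) m) ÷₀ ℕtoℚ (m !) ≡ sgn m * ℕtoℚ (x C m)
    rising-neg-÷₀-! x = begin
      ℤtoℚ (rising (ℤ.- + x) m) ÷₀ ℕtoℚ (m !)
        ≡⟨ cong₂ _÷₀_ (trans (rising-neg x m) (trans (cong (sgn m *_) (ℕtoℚ-* (m !) (x C m)))
             (solve 3 (λ s f c → s :* (f :* c) := f :* (s :* c)) refl (sgn m) (ℕtoℚ (m !)) (ℕtoℚ (x C m)))))
           (sym (ℚ.*-identityʳ (ℕtoℚ (m !)))) ⟩
      (ℕtoℚ (m !) * (sgn m * ℕtoℚ (x C m))) ÷₀ (ℕtoℚ (m !) * 1ℚ)
        ≡⟨ ÷₀-cancelˡ _ 1ℚ m!≢0 ⟩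
      (sgn m * ℕtoℚ (x C m)) ÷₀ 1ℚ
        ≡⟨ ÷₀-1 _ ⟩
      sgn m * ℕtoℚ (x C m)
        ∎
      where open ≡-Reasoning


module AlternatingSums where
  open import Data.Nat.Base as ℕ using (ℕ; zero; suc)
  import Data.Nat.Properties as ℕ
  open import Data.Nat.Combinatorics using (_C_; nCk+nC[k+1]≡[n+1]C[k+1]; k>n⇒nCk≡0)
  open import Data.Rational.Base
  open import Data.Rational.Properties using (+-assoc)
  open import Data.Rational.Solver using (module +-*-Solver)
  open import Data.Nat.ListAction using (sum)
  open import Data.List.Base using (map; upTo)
  open import Data.List.Properties using (map-cong)
  open import Function.Base using (_∘_)
  open import Relation.Binary.PropositionalEquality
  open import Defs using (ℕtoℚ; sgn; c; d; cr; divisors)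
  open ℚ-Sums
  open Rationals using (ℕtoℚ-+; ℕtoℚ-sum; Σ-map-neg)
  open Divisors using (∈-divisors⁻; ∣⇒positive)
  open TupleCounting using (d-suc; c-suc)
  open +-*-Solver

  altSum : ℕ → (ℕ → ℚ) → ℚ
  altSum j f = Σ (map (λ i → sgn i * ℕtoℚ (j C i) * f i) (upTo (suc j)))

  altSum-cong : ∀ j {f g : ℕ → ℚ} → (∀ i → f i ≡ g i) → altSum j f ≡ altSum j g
  altSum-cong j f≡g = cong Σ (map-cong (λ i → cong (sgn i * ℕtoℚ (j C i) *_) (f≡g i)) (upTo (suc j)))

  private
    term : ℕ → (ℕ → ℚ) → ℕ → ℚ
    term j f i = sgn i * ℕtoℚ (j C i) * f i

    term-pascal : ∀ j f i → term (suc j) f (suc i) ≡ term j f (suc i) + - term j (f ∘ suc) i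
    term-pascal j f i = begin
      - sgn i * ℕtoℚ (suc j C suc i) * f (suc i)
        ≡⟨ cong (λ n → - sgn i * ℕtoℚ n * f (suc i)) (sym (nCk+nC[k+1]≡[n+1]C[k+1] j i)) ⟩
      - sgn i * ℕtoℚ ((j C i) ℕ.+ (j C suc i)) * f (suc i)
        ≡⟨ cong (λ q → - sgn i * q * f (suc i)) (ℕtoℚ-+ (j C i) (j C suc i)) ⟩
      - sgn i * (ℕtoℚ (j C i) + ℕtoℚ (j C suc i)) * f (suc i)
        ≡⟨ solve 4 (λ s a b x → :- s :* (a :+ b) :* x := :- s :* b :* x :+ :- (s :* a :* x)) refl
             (sgn i) (ℕtoℚ (j C i)) (ℕtoℚ (j C suc i)) (f (suc i)) ⟩
      term j f (suc i) + - term j (f ∘ suc) i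
        ∎
      where open ≡-Reasoning

    term-beyond : ∀ j f → term j f (suc j) ≡ 0ℚ
    term-beyond j f = begin
      sgn (suc j) * ℕtoℚ (j C suc j) * f (suc j)
        ≡⟨ cong (λ n → sgn (suc j) * ℕtoℚ n * f (suc j)) (k>n⇒nCk≡0 (ℕ.n<1+n j)) ⟩
      sgn (suc j) * 0ℚ * f (suc j)
        ≡⟨ solve 2 (λ s x → s :* con 0ℚ :* x := con 0ℚ) refl (sgn (suc j)) (f (suc j)) ⟩
      0ℚ
        ∎
      where open ≡-Reasoning

  altSum-suc : ∀ j f → altSum (suc j) f ≡ altSum j f - altSum j (f ∘ suc)
  altSum-suc j f = begin
    altSum (suc j) f
      ≡⟨ Σ-upTo-suc (term (suc j) f) (suc j) ⟩
    t 0 + Σ (map (term (suc j) f ∘ suc) js)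
      ≡⟨ cong (t 0 +_) (trans (cong Σ (map-cong (term-pascal j f) js)) (Σ-map-+ (t ∘ suc) (λ i → - u i) js)) ⟩
    t 0 + (Σ (map (t ∘ suc) js) + Σ (map (λ i → - u i) js))
      ≡⟨ sym (+-assoc (t 0) _ _) ⟩
    (t 0 + Σ (map (t ∘ suc) js)) + Σ (map (λ i → - u i) js)
      ≡⟨ cong₂ _+_ (trans (sym (Σ-upTo-suc t (suc j))) (Σ-upTo-∷ʳ t (suc j))) (Σ-map-neg u js) ⟩
    (altSum j f + t (suc j)) - altSum j (f ∘ suc)
      ≡⟨ cong (λ x → (altSum j f + x) - altSum j (f ∘ suc)) (term-beyond j f) ⟩
    (altSum j f + 0ℚ) - altSum j (f ∘ suc)
      ≡⟨ solve 2 (λ a b → (a :+ con 0ℚ) :- b := a :- b) refl (altSum j f) (altSum j (f ∘ suc)) ⟩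
    altSum j f - altSum j (f ∘ suc)
      ∎
    where
    open ≡-Reasoning
    js = upTo (suc j)
    t = term j f
    u = term j (f ∘ suc)

  altSum-Σ : ∀ {A : Set} j (f : A → ℕ → ℚ) xs →
    Σ (map (λ x → altSum j (f x)) xs) ≡ altSum j (λ i → Σ (map (λ x → f x i) xs))
  altSum-Σ j f xs = begin
    Σ (map (λ x → altSum j (f x)) xs)
      ≡⟨ Σ-swap (λ x i → cᵢ i * f x i) xs (upTo (suc j)) ⟩
    Σ (map (λ i → Σ (map (λ x → cᵢ i * f x i) xs)) (upTo (suc j)))
      ≡⟨ cong Σ (map-cong (λ i → Σ-map-*ˡ (cᵢ i) (λ x → f x i) xs) (upTo (suc j))) ⟩
    altSum j (λ i → Σ (map (λ x → f x i) xs))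
      ∎
    where
    open ≡-Reasoning
    cᵢ : ℕ → ℚ
    cᵢ i = sgn i * ℕtoℚ (j C i)

  cr-alternating : ∀ j r {n} → 1 ℕ.≤ n →
                   ℕtoℚ (cr j r n) ≡ sgn j * altSum j (λ i → ℕtoℚ (d (i ℕ.+ r) n))
  cr-alternating zero zero {n} _ =
    solve 1 (λ x → x := con 1ℚ :* (con 1ℚ :* con 1ℚ :* x :+ con 0ℚ)) refl (ℕtoℚ (c 0 n))
  cr-alternating j (suc r) {n} 1≤n = begin
    ℕtoℚ (sum (map (cr j r) (divisors n)))
      ≡⟨ ℕtoℚ-sum (cr j r) (divisors n) ⟩
    Σ (map (ℕtoℚ ∘ cr j r) (divisors n))
      ≡⟨ Σ-map-cong-∈ (divisors n) (λ x∈ → cr-alternating j r (∣⇒positive 1≤n (∈-divisors⁻ x∈))) ⟩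
    Σ (map (λ x → sgn j * altSum j (dᵣ x)) (divisors n))
      ≡⟨ Σ-map-*ˡ (sgn j) (λ x → altSum j (dᵣ x)) (divisors n) ⟩
    sgn j * Σ (map (λ x → altSum j (dᵣ x)) (divisors n))
      ≡⟨ cong (sgn j *_) (altSum-Σ j dᵣ (divisors n)) ⟩
    sgn j * altSum j (λ i → Σ (map (λ x → dᵣ x i) (divisors n)))
      ≡⟨ cong (sgn j *_) (altSum-cong j divisor-sum) ⟩
    sgn j * altSum j (λ i → ℕtoℚ (d (i ℕ.+ suc r) n))
      ∎
    where
    open ≡-Reasoning
    dᵣ : ℕ → ℕ → ℚ
    dᵣ x i = ℕtoℚ (d (i ℕ.+ r) x)
    divisor-sum : ∀ i → Σ (map (λ x → dᵣ x i) (divisors n)) ≡ ℕtoℚ (d (i ℕ.+ suc r) n)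
    divisor-sum i = begin
      Σ (map (λ x → dᵣ x i) (divisors n))          ≡⟨ sym (ℕtoℚ-sum (d (i ℕ.+ r)) (divisors n)) ⟩
      ℕtoℚ (sum (map (d (i ℕ.+ r)) (divisors n)))  ≡⟨ cong ℕtoℚ (sym (d-suc (i ℕ.+ r) 1≤n)) ⟩
      ℕtoℚ (d (suc (i ℕ.+ r)) n)                   ≡⟨ cong (λ k → ℕtoℚ (d k n)) (sym (ℕ.+-suc i r)) ⟩
      ℕtoℚ (d (i ℕ.+ suc r) n)                     ∎
  cr-alternating (suc j) zero {n} 1≤n = begin
    ℕtoℚ (c (suc j) n)
      ≡⟨ solve 2 (λ a b → a := (a :+ b) :- b) refl (ℕtoℚ (c (suc j) n)) (ℕtoℚ (c j n)) ⟩
    (ℕtoℚ (c (suc j) n) + ℕtoℚ (c j n)) - ℕtoℚ (c j n)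
      ≡⟨ cong (_- ℕtoℚ (c j n)) (trans (sym (ℕtoℚ-+ (c (suc j) n) (c j n))) (cong ℕtoℚ (c-suc j 1≤n))) ⟩
    ℕtoℚ (cr j 1 n) - ℕtoℚ (cr j 0 n)
      ≡⟨ cong₂ _-_ (cr-alternating j 1 1≤n) (cr-alternating j 0 1≤n) ⟩
    sgn j * altSum j (λ i → ℕtoℚ (d (i ℕ.+ 1) n)) - sgn j * altSum j f
      ≡⟨ cong (λ x → sgn j * x - sgn j * altSum j f) (altSum-cong j shift) ⟩
    sgn j * altSum j (f ∘ suc) - sgn j * altSum j f
      ≡⟨ solve 3 (λ s a b → s :* a :- s :* b := (:- s) :* (b :- a)) refl (sgn j) (altSum j (f ∘ suc)) (altSum j f) ⟩
    - sgn j * (altSum j f - altSum j (f ∘ suc))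
      ≡⟨ cong (- sgn j *_) (sym (altSum-suc j f)) ⟩
    sgn (suc j) * altSum (suc j) f
      ∎
    where
    open ≡-Reasoning
    f : ℕ → ℚ
    f i = ℕtoℚ (d (i ℕ.+ 0) n)
    shift : ∀ i → ℕtoℚ (d (i ℕ.+ 1) n) ≡ f (suc i)
    shift i = cong (λ k → ℕtoℚ (d k n)) (trans (ℕ.+-comm i 1) (cong suc (sym (ℕ.+-identityʳ i))))


module RatioIdentities where
  open import Data.Nat.Base using (ℕ; suc; _!; _+_; _∸_; _^_; _≤_)
  import Data.Nat.Properties as ℕ
  open import Data.Nat.Combinatorics using (_C_; nCk≡nC[n∸k])
  open import Data.Nat.ListAction using (product)
  open import Data.Rational.Base using (ℚ; 1ℚ; _*_)
  open import Data.Rational.Properties using (*-comm; *-identityʳ)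
  open import Data.Rational.Solver using (module +-*-Solver)
  open import Data.Integer.Base as ℤ using (ℤ; +_)
  open import Data.List.Base using (List; []; _∷_; _++_; map; upTo; length)
  open import Data.List.Properties using (map-cong; map-cong-local; map-++; map-∘)
  import Data.List.Relation.Unary.All as All
  open import Data.List.Membership.Propositional.Properties using (∈-upTo⁻)
  open import Function.Base using (_∘_)
  open import Relation.Binary.PropositionalEquality
    using (_≡_; refl; sym; trans; cong; cong₂; module ≡-Reasoning)
  open import Defs using (ℕtoℚ; ℤtoℚ; sgn; prodℚ; _÷₀_; rising; hypTerm; copies; sum₁; sum₂; hyp₁; hyp₂)
  open ℚ-Sums
  open Rationals
  open TotalDivision
  open AlternatingSums using (altSum)
  open Binomial using (C≢0)
  open DivisorFunction using (d-pow; +suc∸1; d-pow-ratio₁; d-pow-ratio₂)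
  open RisingFactorial using (1-[1+x]≡-x; rising-neg-÷₀; rising-pos-÷₀; rising-neg-÷₀-!)
  open +-*-Solver

  ratio-expand : ∀ j g Y → (sgn j * altSum j g) ÷₀ Y ≡
    Σ (map (λ i → (sgn j * (sgn i * ℕtoℚ (j C i) * g i)) ÷₀ Y) (upTo (suc j)))
  ratio-expand j g Y = trans
    (cong (_÷₀ Y) (sym (Σ-map-*ˡ (sgn j) (λ i → sgn i * ℕtoℚ (j C i) * g i) (upTo (suc j)))))
    (sym (Σ-map-÷₀ (λ i → sgn j * (sgn i * ℕtoℚ (j C i) * g i)) (upTo (suc j)) Y))

  ÷₀-scalar : ∀ s s′ c y Y → (s * (s′ * c * y)) ÷₀ Y ≡ (s * s′ * c) * (y ÷₀ Y)
  ÷₀-scalar s s′ c y Y = trans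
    (cong (_÷₀ Y) (solve 4 (λ s s′ c y → s :* (s′ :* c :* y) := s :* s′ :* c :* y) refl s s′ c y))
    (sym (*-÷₀ (s * s′ * c) y Y))

  hypTerm-split : ∀ xs ys j m → let R = λ a → ℤtoℚ (rising a m) in
    hypTerm (xs ++ (ℤ.- + j) ∷ []) ys m ≡ (prodℚ (map R xs) ÷₀ prodℚ (map R ys)) * (sgn m * ℕtoℚ (j C m))
  hypTerm-split xs ys j m = begin
    prodℚ (map R (xs ++ β ∷ [])) ÷₀ (Y * ℕtoℚ (m !))
      ≡⟨ cong (_÷₀ (Y * ℕtoℚ (m !)))
              (trans (cong prodℚ (map-++ R xs (β ∷ []))) (prodℚ-++ (map R xs) (R β ∷ []))) ⟩
    (X * (R β * 1ℚ)) ÷₀ (Y * ℕtoℚ (m !))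
      ≡⟨ ÷₀-* X (R β * 1ℚ) Y (ℕtoℚ (m !)) ⟩
    (X ÷₀ Y) * ((R β * 1ℚ) ÷₀ ℕtoℚ (m !))
      ≡⟨ cong ((X ÷₀ Y) *_) (trans (cong (_÷₀ ℕtoℚ (m !)) (*-identityʳ (R β))) (rising-neg-÷₀-! m j)) ⟩
    (X ÷₀ Y) * (sgn m * ℕtoℚ (j C m))
      ∎
    where
    open ≡-Reasoning
    β = ℤ.- + j
    R : ℤ → ℚ
    R a = ℤtoℚ (rising a m)
    X = prodℚ (map R xs)
    Y = prodℚ (map R ys)

  module _ (as : List ℕ) where

    Πₐ : (ℕ → ℚ) → ℚ
    Πₐ f = prodℚ (map f as)

    d-exps : ℕ → ℚ
    d-exps k = ℕtoℚ (product (map (d-pow k) as))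

    d-exps-÷₀ : ∀ k k′ → d-exps k ÷₀ d-exps k′ ≡ Πₐ (λ a → d-pow k a ÷ℕ d-pow k′ a)
    d-exps-÷₀ k k′ = trans (cong₂ _÷₀_ (ℕtoℚ-product (d-pow k) as) (ℕtoℚ-product (d-pow k′) as))
      (sym (prodℚ-map-÷₀ (ℕtoℚ ∘ d-pow k) (ℕtoℚ ∘ d-pow k′) as))

    module _ (j r : ℕ) where

      private
        M = j + r ∸ 1

      -- The common value of the i-th terms of ratio₁, sum₁ and hyp₁.
      term₁ : ℕ → ℚ
      term₁ i = (sgn i * ℕtoℚ (j C i)) * Πₐ (λ a → (M C i) ÷ℕ ((a + j + r ∸ 1) C i))

      ratio-term₁ : 1 ≤ j → All.All (1 ≤_) as → ∀ {i} → i ≤ j →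
        (sgn j * (sgn (j ∸ i) * ℕtoℚ (j C (j ∸ i)) * d-exps (j ∸ i + r))) ÷₀ d-exps (j + r) ≡ term₁ i
      ratio-term₁ 1≤j as≥1 {i} i≤j = begin
        (sgn j * (sgn (j ∸ i) * ℕtoℚ (j C (j ∸ i)) * d-exps (j ∸ i + r))) ÷₀ d-exps (j + r)
          ≡⟨ ÷₀-scalar (sgn j) (sgn (j ∸ i)) (ℕtoℚ (j C (j ∸ i))) (d-exps (j ∸ i + r)) (d-exps (j + r)) ⟩
        (sgn j * sgn (j ∸ i) * ℕtoℚ (j C (j ∸ i))) * (d-exps (j ∸ i + r) ÷₀ d-exps (j + r))
          ≡⟨ cong₂ _*_ (cong₂ _*_ signs (cong ℕtoℚ (sym (nCk≡nC[n∸k] i≤j))))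
                       (d-exps-÷₀ (j ∸ i + r) (j + r)) ⟩
        (sgn i * ℕtoℚ (j C i)) * Πₐ (λ a → d-pow (j ∸ i + r) a ÷ℕ d-pow (j + r) a)
          ≡⟨ cong ((sgn i * ℕtoℚ (j C i)) *_) (cong prodℚ (map-cong-local (All.map cross as≥1))) ⟩
        term₁ i
          ∎
        where
        open ≡-Reasoning
        signs : sgn j * sgn (j ∸ i) ≡ sgn i
        signs = trans (sgn-∸ (ℕ.m∸n≤m j i)) (cong sgn (ℕ.m∸[m∸n]≡n i≤j))
        1≤j+r : 1 ≤ j + r
        1≤j+r = ℕ.≤-trans 1≤j (ℕ.m≤m+n j r)
        cross : ∀ {a} → 1 ≤ a → d-pow (j ∸ i + r) a ÷ℕ d-pow (j + r) a ≡ (M C i) ÷ℕ ((a + j + r ∸ 1) C i)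
        cross {suc a} 1≤a = ÷ℕ-cross {d-pow (j ∸ i + r) (suc a)} {M C i}
          (C≢0 (ℕ.≤-trans (ℕ.m≤m+n (suc a) M) (ℕ.≤-reflexive (sym (ℕ.+-∸-assoc (suc a) 1≤j+r)))))
          (C≢0 (ℕ.≤-trans i≤j (ℕ.≤-trans (ℕ.m≤n+m j a) (ℕ.m≤m+n (a + j) r))))
          (d-pow-ratio₁ r 1≤a 1≤j i≤j)

      sum-term₁ : ∀ i →
        (sgn i * ℕtoℚ (j C i) * ℕtoℚ ((M C i) ^ length as)) ÷₀ Πₐ (λ a → ℕtoℚ ((a + j + r ∸ 1) C i))
        ≡ term₁ i
      sum-term₁ i = begin
        (sgn i * ℕtoℚ (j C i) * ℕtoℚ ((M C i) ^ length as)) ÷₀ Q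
          ≡⟨ sym (*-÷₀ (sgn i * ℕtoℚ (j C i)) _ Q) ⟩
        (sgn i * ℕtoℚ (j C i)) * (ℕtoℚ ((M C i) ^ length as) ÷₀ Q)
          ≡⟨ cong (λ x → (sgn i * ℕtoℚ (j C i)) * (x ÷₀ Q)) (ℕtoℚ-^-length (M C i) as) ⟩
        (sgn i * ℕtoℚ (j C i)) * (Πₐ (λ _ → ℕtoℚ (M C i)) ÷₀ Q)
          ≡⟨ cong ((sgn i * ℕtoℚ (j C i)) *_) (sym (prodℚ-map-÷₀ (λ _ → ℕtoℚ (M C i)) q as)) ⟩
        term₁ i
          ∎
        where
        open ≡-Reasoning
        q : ℕ → ℚ
        q a = ℕtoℚ ((a + j + r ∸ 1) C i)
        Q = Πₐ q

      ratio₁≡sum₁ : 1 ≤ j → All.All (1 ≤_) as →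
        (sgn j * altSum j (λ i → d-exps (i + r))) ÷₀ d-exps (j + r) ≡ sum₁ j r as
      ratio₁≡sum₁ 1≤j as≥1 = begin
        (sgn j * altSum j (λ i → d-exps (i + r))) ÷₀ d-exps (j + r)
          ≡⟨ ratio-expand j (λ i → d-exps (i + r)) (d-exps (j + r)) ⟩
        Σ (map T (upTo (suc j)))
          ≡⟨ Σ-upTo-reverse T j ⟩
        Σ (map (λ i → T (j ∸ i)) (upTo (suc j)))
          ≡⟨ Σ-map-cong-∈ (upTo (suc j)) (λ i∈ → ratio-term₁ 1≤j as≥1 (ℕ.≤-pred (∈-upTo⁻ i∈))) ⟩
        Σ (map term₁ (upTo (suc j)))
          ≡⟨ sym (cong Σ (map-cong sum-term₁ (upTo (suc j)))) ⟩
        sum₁ j r as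
          ∎
        where
        open ≡-Reasoning
        T : ℕ → ℚ
        T i = (sgn j * (sgn i * ℕtoℚ (j C i) * d-exps (i + r))) ÷₀ d-exps (j + r)

      hyp-term₁ : 1 ≤ j → ∀ m →
        hypTerm (copies (length as) (+ 1 ℤ.- + (j + r)) ++ (ℤ.- + j) ∷ []) (map (λ a → + 1 ℤ.- + (a + j + r)) as) m
        ≡ term₁ m
      hyp-term₁ 1≤j m = begin
        hypTerm (copies (length as) α ++ (ℤ.- + j) ∷ []) (map β as) m
          ≡⟨ hypTerm-split (copies (length as) α) (map β as) j m ⟩
        (prodℚ (map R (copies (length as) α)) ÷₀ prodℚ (map R (map β as))) * (sgn m * ℕtoℚ (j C m))
          ≡⟨ cong (_* (sgn m * ℕtoℚ (j C m)))
                  (trans (cong₂ _÷₀_ (prodℚ-copies R α as) (cong prodℚ (sym (map-∘ as))))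
                         (sym (prodℚ-map-÷₀ (λ _ → R α) (R ∘ β) as))) ⟩
        Πₐ (λ a → R α ÷₀ R (β a)) * (sgn m * ℕtoℚ (j C m))
          ≡⟨ cong (_* (sgn m * ℕtoℚ (j C m))) (cong prodℚ (map-cong ratio as)) ⟩
        Πₐ (λ a → (M C m) ÷ℕ ((a + j + r ∸ 1) C m)) * (sgn m * ℕtoℚ (j C m))
          ≡⟨ *-comm (Πₐ (λ a → (M C m) ÷ℕ ((a + j + r ∸ 1) C m))) (sgn m * ℕtoℚ (j C m)) ⟩
        term₁ m
          ∎
        where
        open ≡-Reasoning
        α = + 1 ℤ.- + (j + r)
        β : ℕ → ℤ
        β a = + 1 ℤ.- + (a + j + r)
        R : ℤ → ℚ
        R x = ℤtoℚ (rising x m)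
        1-n≡-[n-1] : ∀ {n} → 1 ≤ n → + 1 ℤ.- + n ≡ ℤ.- + (n ∸ 1)
        1-n≡-[n-1] {suc n} _ = 1-[1+x]≡-x n
        1≤j+r = ℕ.≤-trans 1≤j (ℕ.m≤m+n j r)
        1≤a+j+r : ∀ a → 1 ≤ a + j + r
        1≤a+j+r a =
          ℕ.≤-trans 1≤j+r (ℕ.≤-trans (ℕ.m≤n+m (j + r) a) (ℕ.≤-reflexive (sym (ℕ.+-assoc a j r))))
        ratio : ∀ a → R α ÷₀ R (β a) ≡ (M C m) ÷ℕ ((a + j + r ∸ 1) C m)
        ratio a = trans (cong₂ (λ x y → R x ÷₀ R y) (1-n≡-[n-1] 1≤j+r) (1-n≡-[n-1] (1≤a+j+r a)))
                        (rising-neg-÷₀ m M (a + j + r ∸ 1))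

      sum₁≡hyp₁ : 1 ≤ j → sum₁ j r as ≡ hyp₁ j r as
      sum₁≡hyp₁ 1≤j = cong Σ (map-cong (λ i → trans (sum-term₁ i) (sym (hyp-term₁ 1≤j i))) (upTo (suc j)))

    module _ (j R : ℕ) where

      private
        r = suc R

      -- The common value of the i-th terms of ratio₂, sum₂ and hyp₂.
      term₂ : ℕ → ℚ
      term₂ i = (sgn (j ∸ i) * ℕtoℚ (j C i)) * Πₐ (λ a → ((a + i + r ∸ 1) C i) ÷ℕ ((i + r ∸ 1) C i))

      ratio-term₂ : ∀ {i} → i ≤ j → (sgn j * (sgn i * ℕtoℚ (j C i) * d-exps (i + r))) ÷₀ d-exps r ≡ term₂ i
      ratio-term₂ {i} i≤j = begin
        (sgn j * (sgn i * ℕtoℚ (j C i) * d-exps (i + r))) ÷₀ d-exps r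
          ≡⟨ ÷₀-scalar (sgn j) (sgn i) (ℕtoℚ (j C i)) (d-exps (i + r)) (d-exps r) ⟩
        (sgn j * sgn i * ℕtoℚ (j C i)) * (d-exps (i + r) ÷₀ d-exps r)
          ≡⟨ cong₂ _*_ (cong (_* ℕtoℚ (j C i)) (sgn-∸ i≤j)) (d-exps-÷₀ (i + r) r) ⟩
        (sgn (j ∸ i) * ℕtoℚ (j C i)) * Πₐ (λ a → d-pow (i + r) a ÷ℕ d-pow r a)
          ≡⟨ cong ((sgn (j ∸ i) * ℕtoℚ (j C i)) *_) (cong prodℚ (map-cong cross as)) ⟩
        term₂ i
          ∎
        where
        open ≡-Reasoning
        cross : ∀ a → d-pow (i + r) a ÷ℕ d-pow r a ≡ ((a + i + r ∸ 1) C i) ÷ℕ ((i + r ∸ 1) C i)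
        cross a = ÷ℕ-cross {d-pow (i + r) a} {(a + i + r ∸ 1) C i}
          (C≢0 (ℕ.≤-trans (ℕ.m≤m+n a R) (ℕ.≤-reflexive (sym (+suc∸1 a R)))))
          (C≢0 (ℕ.≤-trans (ℕ.m≤m+n i R) (ℕ.≤-reflexive (sym (+suc∸1 i R)))))
          (d-pow-ratio₂ a i R)

      sum-term₂ : ∀ i →
        (sgn (j ∸ i) * ℕtoℚ (j C i) * Πₐ (λ a → ℕtoℚ ((a + i + r ∸ 1) C i)))
          ÷₀ ℕtoℚ (((i + r ∸ 1) C i) ^ length as)
        ≡ term₂ i
      sum-term₂ i = begin
        (sgn (j ∸ i) * ℕtoℚ (j C i) * P) ÷₀ ℕtoℚ (cᵢ ^ length as)
          ≡⟨ sym (*-÷₀ (sgn (j ∸ i) * ℕtoℚ (j C i)) P (ℕtoℚ (cᵢ ^ length as))) ⟩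
        (sgn (j ∸ i) * ℕtoℚ (j C i)) * (P ÷₀ ℕtoℚ (cᵢ ^ length as))
          ≡⟨ cong (λ x → (sgn (j ∸ i) * ℕtoℚ (j C i)) * (P ÷₀ x)) (ℕtoℚ-^-length cᵢ as) ⟩
        (sgn (j ∸ i) * ℕtoℚ (j C i)) * (P ÷₀ Πₐ (λ _ → ℕtoℚ cᵢ))
          ≡⟨ cong ((sgn (j ∸ i) * ℕtoℚ (j C i)) *_) (sym (prodℚ-map-÷₀ p (λ _ → ℕtoℚ cᵢ) as)) ⟩
        term₂ i
          ∎
        where
        open ≡-Reasoning
        cᵢ = (i + r ∸ 1) C i
        p : ℕ → ℚ
        p a = ℕtoℚ ((a + i + r ∸ 1) C i)
        P = Πₐ p

      ratio₂≡sum₂ : (sgn j * altSum j (λ i → d-exps (i + r))) ÷₀ d-exps r ≡ sum₂ j r as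
      ratio₂≡sum₂ = begin
        (sgn j * altSum j (λ i → d-exps (i + r))) ÷₀ d-exps r
          ≡⟨ ratio-expand j (λ i → d-exps (i + r)) (d-exps r) ⟩
        Σ (map (λ i → (sgn j * (sgn i * ℕtoℚ (j C i) * d-exps (i + r))) ÷₀ d-exps r) (upTo (suc j)))
          ≡⟨ Σ-map-cong-∈ (upTo (suc j)) (λ i∈ → ratio-term₂ (ℕ.≤-pred (∈-upTo⁻ i∈))) ⟩
        Σ (map term₂ (upTo (suc j)))
          ≡⟨ sym (cong Σ (map-cong sum-term₂ (upTo (suc j)))) ⟩
        sum₂ j r as
          ∎
        where open ≡-Reasoning

      hyp-term₂ : ∀ {m} → m ≤ j →
        sgn j * hypTerm (map (λ a → + (a + r)) as ++ (ℤ.- + j) ∷ []) (copies (length as) (+ r)) m ≡ term₂ m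
      hyp-term₂ {m} m≤j = begin
        sgn j * hypTerm (map α as ++ (ℤ.- + j) ∷ []) (copies (length as) (+ r)) m
          ≡⟨ cong (sgn j *_) (hypTerm-split (map α as) (copies (length as) (+ r)) j m) ⟩
        sgn j * ((prodℚ (map Rm (map α as)) ÷₀ prodℚ (map Rm (copies (length as) (+ r)))) * (sgn m * ℕtoℚ (j C m)))
          ≡⟨ cong (λ x → sgn j * (x * (sgn m * ℕtoℚ (j C m))))
                  (trans (cong₂ _÷₀_ (cong prodℚ (sym (map-∘ as))) (prodℚ-copies Rm (+ r) as))
                         (sym (prodℚ-map-÷₀ (Rm ∘ α) (λ _ → Rm (+ r)) as))) ⟩
        sgn j * (X * (sgn m * ℕtoℚ (j C m)))
          ≡⟨ solve 4 (λ s x t c → s :* (x :* (t :* c)) := s :* t :* c :* x) refl (sgn j) X (sgn m) (ℕtoℚ (j C m)) ⟩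
        sgn j * sgn m * ℕtoℚ (j C m) * X
          ≡⟨ cong₂ _*_ (cong (_* ℕtoℚ (j C m)) (sgn-∸ m≤j)) (cong prodℚ (map-cong ratio as)) ⟩
        term₂ m
          ∎
        where
        open ≡-Reasoning
        α : ℕ → ℤ
        α a = + (a + r)
        Rm : ℤ → ℚ
        Rm x = ℤtoℚ (rising x m)
        X = Πₐ (λ a → Rm (α a) ÷₀ Rm (+ r))
        index : ∀ a → a + R + m ≡ a + m + suc R ∸ 1
        index a = begin
          a + R + m        ≡⟨ ℕ.+-assoc a R m ⟩
          a + (R + m)      ≡⟨ cong (_+_ a) (ℕ.+-comm R m) ⟩
          a + (m + R)      ≡⟨ sym (ℕ.+-assoc a m R) ⟩
          a + m + R        ≡⟨ sym (+suc∸1 (a + m) R) ⟩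
          a + m + suc R ∸ 1 ∎
        ratio : ∀ a → Rm (α a) ÷₀ Rm (+ r) ≡ ((a + m + r ∸ 1) C m) ÷ℕ ((m + r ∸ 1) C m)
        ratio a = begin
          Rm (+ (a + suc R)) ÷₀ Rm (+ suc R)
            ≡⟨ cong (λ n → Rm (+ n) ÷₀ Rm (+ suc R)) (ℕ.+-suc a R) ⟩
          Rm (+ suc (a + R)) ÷₀ Rm (+ suc R)
            ≡⟨ rising-pos-÷₀ m (a + R) R ⟩
          ((a + R + m) C m) ÷ℕ ((R + m) C m)
            ≡⟨ cong₂ (λ x y → (x C m) ÷ℕ (y C m)) (index a) (trans (ℕ.+-comm R m) (sym (+suc∸1 m R))) ⟩
          ((a + m + suc R ∸ 1) C m) ÷ℕ ((m + suc R ∸ 1) C m)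
            ∎

      sum₂≡hyp₂ : sum₂ j r as ≡ hyp₂ j r as
      sum₂≡hyp₂ = begin
        sum₂ j r as
          ≡⟨ cong Σ (map-cong sum-term₂ (upTo (suc j))) ⟩
        Σ (map term₂ (upTo (suc j)))
          ≡⟨ Σ-map-cong-∈ (upTo (suc j)) (λ m∈ → sym (hyp-term₂ (ℕ.≤-pred (∈-upTo⁻ m∈)))) ⟩
        Σ (map (λ m → sgn j * H m) (upTo (suc j)))
          ≡⟨ Σ-map-*ˡ (sgn j) H (upTo (suc j)) ⟩
        hyp₂ j r as
          ∎
        where
        open ≡-Reasoning
        H = hypTerm (map (λ a → + (a + r)) as ++ (ℤ.- + j) ∷ []) (copies (length as) (+ r))


module Factorised {n : ℕ} (F : Factorisation n) where
  open import Data.Nat.Base using (_+_; suc)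
  open import Data.Rational.Base using (_*_)
  import Data.List.Relation.Unary.All.Properties as All
  open import Relation.Binary.PropositionalEquality using (_≡_; subst; trans; cong; cong₂)
  open import Data.List.Base using (map)
  open import Data.Nat.ListAction using (product)
  open DivisorFunction using (d-pow; value-positive; d-value)
  open AlternatingSums using (altSum; altSum-cong; cr-alternating)
  open RatioIdentities

  private
    as = exponents F

  d-factorised : ∀ k → ℕtoℚ (d k n) ≡ d-exps as k
  d-factorised k = cong ℕtoℚ (subst (λ m → d k m ≡ product (map (d-pow k) as)) (prodEq F)
                                    (d-value k (factors F) (primes F) (distinct F)))

  cr-factorised : ∀ j r → ℕtoℚ (cr j r n) ≡ sgn j * altSum j (λ i → d-exps as (i + r))
  cr-factorised j r = trans (cr-alternating j r (subst (1 ≤_) (prodEq F) (value-positive (factors F) (primes F))))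
    (cong (sgn j *_) (altSum-cong j (λ i → d-factorised (i + r))))

  ratio₁≡sum₁≡hyp₁ : ∀ j r → 1 ≤ j → (ratio₁ j r n ≡ sum₁ j r as) × (sum₁ j r as ≡ hyp₁ j r as)
  ratio₁≡sum₁≡hyp₁ j r 1≤j =
    trans (cong₂ _÷₀_ (cr-factorised j r) (d-factorised (j + r)))
          (ratio₁≡sum₁ as j r 1≤j (All.map⁺ (exps F))) ,
    sum₁≡hyp₁ as j r 1≤j

  ratio₂≡sum₂≡hyp₂ : ∀ j r → 1 ≤ r → (ratio₂ j r n ≡ sum₂ j r as) × (sum₂ j r as ≡ hyp₂ j r as)
  ratio₂≡sum₂≡hyp₂ j (suc R) _ =
    trans (cong₂ _÷₀_ (cr-factorised j (suc R)) (d-factorised (suc R))) (ratio₂≡sum₂ as j R) ,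
    sum₂≡hyp₂ as j R


theorem22 : (j r n : ℕ) → 1 ≤ j → (F : Factorisation n) →
  ((ratio₁ j r n ≡ sum₁ j r (exponents F)) × (sum₁ j r (exponents F) ≡ hyp₁ j r (exponents F)))
  × (1 ≤ r →
    (ratio₂ j r n ≡ sum₂ j r (exponents F)) × (sum₂ j r (exponents F) ≡ hyp₂ j r (exponents F)))
theorem22 j r n 1≤j F = ratio₁≡sum₁≡hyp₁ j r 1≤j , ratio₂≡sum₂≡hyp₂ j r
  where open Factorised F
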